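{- For every $d\geq 1$, the Aperiodic Domino problem — given as input an effective (recursively enumerable) family $\mathcal{F}$ of $d$-dimensional patterns, decide whether the subshift $X_{\mathcal{F}}\subseteq\Sigma^{\mathbb{Z}^d}$ contains an aperiodic configuration — belongs to $\Sigma_1^1$.
   Context: A configuration is a map $x:\mathbb{Z}^d\to\Sigma$ ($\Sigma$ finite); a pattern is a map $w:D\to\Sigma$, $D\subseteq\mathbb{Z}^d$ finite; $X_{\mathcal{F}}$ is the set of configurations in which no pattern of $\mathcal{F}$ appears (i.e. for no $i$ do we have $x_{i+j}=w_j$ for all $j\in D$). A configuration $x$ is aperiodic if for every nonzero $p\in\mathbb{Z}^d$ there is $i$ with $x_{i+p}\neq x_i$. A decision problem $P$ on $\mathbb{N}$ is $\Sigma_1^1$ if there is an arithmetical relation $R$ with $P(n)=1 \iff \exists f\in 2^{\mathbb{N}}, R^f(n)$, where $R^f$ is $R$ relativized to oracle $f$. -}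

module Defs where

open import Data.Nat using (ℕ; zero; suc; _+_; _*_; _<_; _≤_)
open import Data.Nat.DivMod using (_%_; m%n<n)
open import Data.Bool using (Bool; true)
open import Data.Fin using (Fin; fromℕ<)
open import Data.Integer using (ℤ; +_; -[1+_])
import Data.Integer as ℤ
open import Data.Vec using (Vec; []; _∷_; zipWith; replicate)
open import Data.List using (List; []; _∷_)
open import Data.List.Relation.Unary.All using (All)
open import Data.Product using (Σ; _×_; _,_; proj₁; proj₂)
open import Data.Empty using (⊥)
open import Data.Sum using (_⊎_)
open import Relation.Binary.PropositionalEquality using (_≡_; _≢_)
open import Relation.Nullary using (¬_)

-- Coding of ℕ × ℕ by ℕ (Cantor enumeration of the diagonals)

unpair : ℕ → ℕ × ℕ
unpair zero = 0 , 0
unpair (suc n) with unpair n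
... | a , zero  = 0 , suc a
... | a , suc b = suc a , b

ℤ^ : ℕ → Set
ℤ^ d = Vec ℤ d

_⊕_ : ∀ {d} → ℤ^ d → ℤ^ d → ℤ^ d
_⊕_ = zipWith ℤ._+_

𝟎 : ∀ {d} → ℤ^ d
𝟎 {d} = replicate d (+ 0)

Config : ℕ → Set → Set
Config d A = ℤ^ d → A

-- a pattern w : D → A with D ⊆ ℤ^d finite, given by its graph
-- (a finite list of (position , symbol) pairs)
Pattern : ℕ → Set → Set
Pattern d A = List (ℤ^ d × A)

AppearsAt : ∀ {d A} → Pattern d A → Config d A → ℤ^ d → Set
AppearsAt w x i = All (λ ja → x (i ⊕ proj₁ ja) ≡ proj₂ ja) w

Appears : ∀ {d A} → Pattern d A → Config d A → Set
Appears w x = Σ (ℤ^ _) (AppearsAt w x)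

InSubshift : ∀ {d A} → (Pattern d A → Set) → Config d A → Set
InSubshift F x = ∀ w → F w → ¬ Appears w x

Aperiodic : ∀ {d A} → Config d A → Set
Aperiodic {d} x = ∀ (p : ℤ^ d) → p ≢ 𝟎 → Σ (ℤ^ d) λ i → x (i ⊕ p) ≢ x i

data Code : Set where
  Z    : Code
  S    : Code
  P    : ℕ → Code
  C    : Code → List Code → Code
  R    : Code → Code → Code
  M    : Code → Code

lookupL : List ℕ → ℕ → ℕ → Set
lookupL []       _       _ = ⊥
lookupL (x ∷ xs) zero    y = x ≡ y
lookupL (x ∷ xs) (suc i) y = lookupL xs i y

data Eval : Code → List ℕ → ℕ → Set
data EvalL : List Code → List ℕ → List ℕ → Set

data Eval where
  eZ : ∀ {xs} → Eval Z xs 0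
  eS : ∀ {x xs} → Eval S (x ∷ xs) (suc x)
  eP : ∀ {i xs y} → lookupL xs i y → Eval (P i) xs y
  eC : ∀ {f gs xs ys y} → EvalL gs xs ys → Eval f ys y → Eval (C f gs) xs y
  eR0 : ∀ {f g xs y} → Eval f xs y → Eval (R f g) (0 ∷ xs) y
  eRS : ∀ {f g n xs r y} → Eval (R f g) (n ∷ xs) r →
        Eval g (n ∷ r ∷ xs) y → Eval (R f g) (suc n ∷ xs) y
  eM : ∀ {f xs y} → Eval f (y ∷ xs) 0 →
       (∀ z → z < y → Σ ℕ λ v → Eval f (z ∷ xs) (suc v)) →
       Eval (M f) xs y

data EvalL where
  []  : ∀ {xs} → EvalL [] xs []
  _∷_ : ∀ {g gs xs y ys} → Eval g xs y → EvalL gs xs ys → EvalL (g ∷ gs) xs (y ∷ ys)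

-- Gödel numbering of codes (fuel-bounded decoding; the fuel n suffices
-- for every subterm since all components of unpair m are ≤ m)
decodeCodeF : ℕ → ℕ → Code
decodeCodesF : ℕ → ℕ → List Code
decodeCodeF zero _ = Z
decodeCodeF (suc fuel) n with unpair n
... | 0 , _ = Z
... | 1 , _ = S
... | 2 , i = P i
... | 3 , m = C (decodeCodeF fuel (proj₁ (unpair m))) (decodeCodesF fuel (proj₂ (unpair m)))
... | 4 , m = R (decodeCodeF fuel (proj₁ (unpair m))) (decodeCodeF fuel (proj₂ (unpair m)))
... | 5 , m = M (decodeCodeF fuel m)
... | _ , _ = Z
decodeCodesF zero _ = []
decodeCodesF (suc fuel) zero = []
decodeCodesF (suc fuel) (suc m) =
  decodeCodeF fuel (proj₁ (unpair m)) ∷ decodeCodesF fuel (proj₂ (unpair m))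

decodeCode : ℕ → Code
decodeCode n = decodeCodeF n n

-- W_e : the e-th recursively enumerable set (range of φ_e on one argument;
-- every nonempty r.e. set, and ∅, is of this form)
InRE : ℕ → ℕ → Set
InRE e m = Σ ℕ λ t → Eval (decodeCode e) (t ∷ []) m

decodeℤ : ℕ → ℤ
decodeℤ n with unpair n
... | zero  , a = + a
... | suc _ , a = -[1+ a ]

decodeVec : (d : ℕ) → ℕ → ℤ^ d
decodeVec zero    _ = []
decodeVec (suc d) n = decodeℤ (proj₁ (unpair n)) ∷ decodeVec d (proj₂ (unpair n))

decodeSym : (k : ℕ) → ℕ → Fin (suc k)
decodeSym k n = fromℕ< (m%n<n n (suc k))

decodeEntry : (d k : ℕ) → ℕ → ℤ^ d × Fin (suc k)
decodeEntry d k n = decodeVec d (proj₁ (unpair n)) , decodeSym k (proj₂ (unpair n))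

decodePatternF : (d k : ℕ) → ℕ → ℕ → Pattern d (Fin (suc k))
decodePatternF d k zero _ = []
decodePatternF d k (suc fuel) zero = []
decodePatternF d k (suc fuel) (suc m) =
  decodeEntry d k (proj₁ (unpair m)) ∷ decodePatternF d k fuel (proj₂ (unpair m))

decodePattern : (d k : ℕ) → ℕ → Pattern d (Fin (suc k))
decodePattern d k n = decodePatternF d k n n

-- The Aperiodic Domino problem in dimension d.
-- Input n codes a pair (k , e): alphabet Σ = Fin (suc k) and the effective
-- family F = { decodePattern d k m ∣ m ∈ W_e }.

EffFamily : (d k e : ℕ) → Pattern d (Fin (suc k)) → Set
EffFamily d k e w = Σ ℕ λ m → InRE e m × (decodePattern d k m ≡ w)

AperiodicDomino : ℕ → ℕ → Set
AperiodicDomino d n with unpair n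
... | k , e = Σ (Config d (Fin (suc k))) λ x →
                InSubshift (EffFamily d k e) x × Aperiodic x

-- Arithmetical formulas with an oracle f ∈ 2^ℕ (de Bruijn variables)

data Term : Set where
  var  : ℕ → Term
  zer  : Term
  succ : Term → Term
  _+ₜ_ : Term → Term → Term
  _*ₜ_ : Term → Term → Term

data Formula : Set where
  _≐_   : Term → Term → Formula
  _≺_   : Term → Term → Formula
  orc   : Term → Formula
  ⊥ᶠ    : Formula
  _∧ᶠ_  : Formula → Formula → Formula
  _∨ᶠ_  : Formula → Formula → Formula
  _⇒ᶠ_  : Formula → Formula → Formula
  ∀ᶠ    : Formula → Formula
  ∃ᶠ    : Formula → Formula

Env : Set
Env = ℕ → ℕ

_∷ₑ_ : ℕ → Env → Env
(a ∷ₑ ρ) zero    = a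
(a ∷ₑ ρ) (suc i) = ρ i

⟦_⟧ₜ : Term → Env → ℕ
⟦ var i ⟧ₜ ρ = ρ i
⟦ zer ⟧ₜ ρ = 0
⟦ succ t ⟧ₜ ρ = suc (⟦ t ⟧ₜ ρ)
⟦ t +ₜ u ⟧ₜ ρ = ⟦ t ⟧ₜ ρ + ⟦ u ⟧ₜ ρ
⟦ t *ₜ u ⟧ₜ ρ = ⟦ t ⟧ₜ ρ * ⟦ u ⟧ₜ ρ

Sat : (ℕ → Bool) → Formula → Env → Set
Sat f (t ≐ u) ρ = ⟦ t ⟧ₜ ρ ≡ ⟦ u ⟧ₜ ρ
Sat f (t ≺ u) ρ = ⟦ t ⟧ₜ ρ < ⟦ u ⟧ₜ ρ
Sat f (orc t) ρ = f (⟦ t ⟧ₜ ρ) ≡ true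
Sat f ⊥ᶠ ρ = ⊥
Sat f (φ ∧ᶠ ψ) ρ = Sat f φ ρ × Sat f ψ ρ
Sat f (φ ∨ᶠ ψ) ρ = Sat f φ ρ ⊎ Sat f ψ ρ
Sat f (φ ⇒ᶠ ψ) ρ = Sat f φ ρ → Sat f ψ ρ
Sat f (∀ᶠ φ) ρ = ∀ a → Sat f φ (a ∷ₑ ρ)
Sat f (∃ᶠ φ) ρ = Σ ℕ λ a → Sat f φ (a ∷ₑ ρ)

IsΣ¹₁ : (ℕ → Set) → Set
IsΣ¹₁ Prob = Σ Formula λ φ → ∀ n →
  (Prob n → Σ (ℕ → Bool) λ f → Sat f φ (n ∷ₑ λ _ → 0)) ×
  (Σ (ℕ → Bool) (λ f → Sat f φ (n ∷ₑ λ _ → 0)) → Prob n)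

-- The Σ¹₁ witness is an oracle f ∈ 2^ℕ that lists the configuration (which symbol sits at each
-- coded position of ℤ^d) together with tables meant to be the graph of a fuel-bounded evaluator
-- of μ-recursive codes.  The arithmetical part does not arithmetise computation; it only asks
-- that the evaluation tables be closed under the clauses of evaluation.  Any such table contains
-- the least one, i.e. every true evaluation, which suffices to check that no pattern of
-- the r.e. family appears; conversely the graph of the actual evaluator is closed under the
-- clauses, so every aperiodic point of X_F yields an oracle.  Everything else the formula needs is
-- polynomial: Cantor pairing after doubling, integers as differences of naturals, and lists and
-- vectors by iterated pairing.
module Submission where

open import Defs
open import Data.Bool using (Bool; true; false)
open import Data.Fin using (Fin; toℕ; fromℕ<)
open import Data.Fin.Properties using (toℕ-fromℕ<; toℕ<n; toℕ-injective) renaming (_≟_ to _≟ᶠ_)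
open import Data.Integer as ℤ using (ℤ; +_; -[1+_]; _⊖_)
open import Data.Integer.Properties using ([+m]-[+n]≡m⊖n) renaming (+-injective to +ℤ-injective)
open import Data.Integer.Solver renaming (module +-*-Solver to ℤ-Solver)
open import Data.List using (List; []; _∷_; map)
open import Data.List.Membership.Propositional using (_∈_; find)
open import Data.List.Membership.Propositional.Properties using (∈-map⁺; ∈-map⁻)
import Data.List.Properties as List
import Data.List.Relation.Unary.All as All
open import Data.List.Relation.Unary.All.Properties using (¬All⇒Any¬)
open import Data.List.Relation.Unary.Any using (here; there)
open import Data.Maybe using (Maybe; just; nothing; _>>=_; fromMaybe)
import Data.Maybe.Properties as Maybe
open import Data.Nat using (ℕ; zero; suc; _+_; _*_; _≤_; _<_; z≤n; s≤s; _⊔_; _≤′_; ≤′-refl; ≤′-step; ⌊_/2⌋; _≟_)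
open import Data.Nat.Properties
open import Data.List.Membership.DecPropositional _≟_ using (_∈?_)
open import Data.Nat.DivMod using (_%_; _/_; m%n<n; m≡m%n+[m/n]*n; [m+kn]%n≡m%n; m<n⇒m%n≡m)
open import Data.Nat.Solver renaming (module +-*-Solver to ℕ-Solver)
open import Data.Product using (Σ; _×_; _,_; proj₁; proj₂)
open import Data.Sum using (_⊎_; inj₁; inj₂)
open import Data.Vec using ([]; _∷_)
open import Data.Vec.Properties using (∷-injective)
open import Function using (_∘_; _⇔_; mk⇔; Equivalence)
open import Function.Construct.Composition using (_⇔-∘_)
open import Function.Construct.Symmetry using (⇔-sym)
open import Relation.Binary.PropositionalEquality
open import Relation.Nullary using (Dec; yes; no; does; ¬_; contradiction)

open Equivalence

triangle : ℕ → ℕ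
triangle zero    = 0
triangle (suc s) = triangle s + suc s

pair : ℕ → ℕ → ℕ
pair a b = triangle (a + b) + a

pair-suc : ∀ a b → pair (suc a) b ≡ suc (pair a (suc b))
pair-suc a b rewrite +-suc a b = +-suc (triangle (suc (a + b))) a

pair-zero : ∀ b → pair 0 (suc b) ≡ suc (pair b 0)
pair-zero b rewrite +-identityʳ b | +-identityʳ (triangle b + suc b) = +-suc (triangle b) b

unpair-pair : ∀ {n} a b → pair a b ≡ n → unpair n ≡ (a , b)
unpair-pair {zero}  zero    zero    _  = refl
unpair-pair {zero}  (suc a) b       eq with () ← trans (sym (pair-suc a b)) eq
unpair-pair {zero}  zero    (suc b) eq with () ← trans (sym (pair-zero b)) eq
unpair-pair {suc n} zero    zero    ()
unpair-pair {suc n} (suc a) b       eq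
  with unpair n | unpair-pair a (suc b) (suc-injective (trans (sym (pair-suc a b)) eq))
... | .(a , suc b) | refl = refl
unpair-pair {suc n} zero    (suc b) eq
  with unpair n | unpair-pair b 0 (suc-injective (trans (sym (pair-zero b)) eq))
... | .(b , 0) | refl = refl

pair-unpair : ∀ n → pair (proj₁ (unpair n)) (proj₂ (unpair n)) ≡ n
pair-unpair zero = refl
pair-unpair (suc n) with unpair n | pair-unpair n
... | a , zero  | ih = trans (pair-zero a) (cong suc ih)
... | a , suc b | ih = trans (pair-suc a b) (cong suc ih)

proj₂-unpair-≤ : ∀ n → proj₂ (unpair n) ≤ n
proj₂-unpair-≤ n = subst (b ≤_) (pair-unpair n) (begin
    b                    ≤⟨ m≤n+m b a ⟩
    a + b                ≤⟨ triangle-≥ (a + b) ⟩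
    triangle (a + b)     ≤⟨ m≤m+n (triangle (a + b)) a ⟩
    triangle (a + b) + a ∎)
  where
  open ≤-Reasoning
  a = proj₁ (unpair n)
  b = proj₂ (unpair n)
  triangle-≥ : ∀ s → s ≤ triangle s
  triangle-≥ zero    = z≤n
  triangle-≥ (suc s) = m≤n+m (suc s) (triangle s)

-- Twice the pairing function is a polynomial, so "z = pair a b" is the
-- arithmetical equation z + z = twicePair a b (the formula language has no division).
twicePair : ℕ → ℕ → ℕ
twicePair a b = (a + b) * suc (a + b) + (a + a)

twicePair≡pair+pair : ∀ a b → twicePair a b ≡ pair a b + pair a b
twicePair≡pair+pair a b = begin
  (a + b) * suc (a + b) + (a + a)                   ≡⟨ cong (_+ (a + a)) (triangle-double (a + b)) ⟨
  (triangle (a + b) + triangle (a + b)) + (a + a)   ≡⟨ interchange (triangle (a + b)) a ⟩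
  pair a b + pair a b                               ∎
  where
  open ≡-Reasoning
  open ℕ-Solver
  interchange : ∀ t u → (t + t) + (u + u) ≡ (t + u) + (t + u)
  interchange = solve 2 (λ t u → (t :+ t) :+ (u :+ u) := (t :+ u) :+ (t :+ u)) refl
  triangle-double : ∀ s → triangle s + triangle s ≡ s * suc s
  triangle-double zero    = refl
  triangle-double (suc s) = begin
    (triangle s + suc s) + (triangle s + suc s)   ≡⟨ interchange (triangle s) (suc s) ⟨
    (triangle s + triangle s) + (suc s + suc s)   ≡⟨ cong (_+ (suc s + suc s)) (triangle-double s) ⟩
    s * suc s + (suc s + suc s)                   ≡⟨ solve 1 (λ s → s :* (con 1 :+ s) :+ ((con 1 :+ s) :+ (con 1 :+ s))
                                                                := (con 1 :+ s) :* (con 1 :+ (con 1 :+ s))) refl s ⟩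
    suc s * suc (suc s)                           ∎

IsPair : ℕ → ℕ → ℕ → Set
IsPair z a b = z + z ≡ twicePair a b

IsPair⇒≡pair : ∀ {z a b} → IsPair z a b → z ≡ pair a b
IsPair⇒≡pair {z} {a} {b} eq = begin
  z                           ≡⟨ n≡⌊n+n/2⌋ z ⟩
  ⌊ z + z /2⌋                 ≡⟨ cong ⌊_/2⌋ (trans eq (twicePair≡pair+pair a b)) ⟩
  ⌊ pair a b + pair a b /2⌋   ≡⟨ sym (n≡⌊n+n/2⌋ (pair a b)) ⟩
  pair a b                    ∎
  where open ≡-Reasoning

IsPair⇒unpair : ∀ {z a b} → IsPair z a b → unpair z ≡ (a , b)
IsPair⇒unpair {z} {a} {b} eq = unpair-pair a b (sym (IsPair⇒≡pair {z} {a} {b} eq))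

pair-IsPair : ∀ a b → IsPair (pair a b) a b
pair-IsPair a b = sym (twicePair≡pair+pair a b)

unpair⇒IsPair : ∀ z {a b} → unpair z ≡ (a , b) → IsPair z a b
unpair⇒IsPair z {a} {b} eq = subst (λ w → IsPair w a b) z≡pair (pair-IsPair a b)
  where
  z≡pair : pair a b ≡ z
  z≡pair = trans (cong (λ (a , b) → pair a b) (sym eq)) (pair-unpair z)

unpair-IsPair : ∀ z → IsPair z (proj₁ (unpair z)) (proj₂ (unpair z))
unpair-IsPair z = unpair⇒IsPair z refl

IsPair⇒≤ : ∀ {z a b} → IsPair z a b → b ≤ z
IsPair⇒≤ {z} {a} {b} pr = subst (λ (_ , b) → b ≤ z) (IsPair⇒unpair {z} {a} {b} pr) (proj₂-unpair-≤ z)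

decodeListF : ℕ → ℕ → List ℕ
decodeListF zero       _       = []
decodeListF (suc fuel) zero    = []
decodeListF (suc fuel) (suc m) = proj₁ (unpair m) ∷ decodeListF fuel (proj₂ (unpair m))

decodeList : ℕ → List ℕ
decodeList n = decodeListF n n

decodeListF-fuel : ∀ f g n → n ≤ f → n ≤ g → decodeListF f n ≡ decodeListF g n
decodeListF-fuel zero    zero    n       _       _       = refl
decodeListF-fuel zero    (suc g) zero    _       _       = refl
decodeListF-fuel (suc f) zero    zero    _       _       = refl
decodeListF-fuel (suc f) (suc g) zero    _       _       = refl
decodeListF-fuel (suc f) (suc g) (suc m) (s≤s p) (s≤s q) =
  cong (proj₁ (unpair m) ∷_) (decodeListF-fuel f g (proj₂ (unpair m))
    (≤-trans (proj₂-unpair-≤ m) p) (≤-trans (proj₂-unpair-≤ m) q))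

decodeList-suc : ∀ p → decodeList (suc p) ≡ proj₁ (unpair p) ∷ decodeList (proj₂ (unpair p))
decodeList-suc p = cong (proj₁ (unpair p) ∷_)
  (decodeListF-fuel p (proj₂ (unpair p)) (proj₂ (unpair p)) (proj₂-unpair-≤ p) ≤-refl)

decodeList-IsPair : ∀ {p h r} → IsPair p h r → decodeList (suc p) ≡ h ∷ decodeList r
decodeList-IsPair {p} {h} {r} pr with unpair p | IsPair⇒unpair {p} {h} {r} pr | decodeList-suc p
... | .(h , r) | refl | eq = eq

decodeList-cons : ∀ h {n xs} → decodeList n ≡ xs → decodeList (suc (pair h n)) ≡ h ∷ xs
decodeList-cons h {n} dn = trans (decodeList-IsPair {pair h n} {h} {n} (pair-IsPair h n)) (cong (h ∷_) dn)

decodeList-∷⁻ : ∀ n {h t} → decodeList n ≡ h ∷ t →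
  Σ ℕ λ p → Σ ℕ λ q → n ≡ suc p × IsPair p h q × decodeList q ≡ t
decodeList-∷⁻ (suc p) eq with trans (sym (decodeList-suc p)) eq
... | refl = p , proj₂ (unpair p) , refl , unpair-IsPair p , refl

decodePattern≡map : ∀ d k m → decodePattern d k m ≡ map (decodeEntry d k) (decodeList m)
decodePattern≡map d k m = go m m
  where
  go : ∀ f m → decodePatternF d k f m ≡ map (decodeEntry d k) (decodeListF f m)
  go zero    m       = refl
  go (suc f) zero    = refl
  go (suc f) (suc m) = cong (decodeEntry d k (proj₁ (unpair m)) ∷_) (go f (proj₂ (unpair m)))

lookup? : List ℕ → ℕ → Maybe ℕ
lookup? []       i       = nothing
lookup? (x ∷ xs) zero    = just x
lookup? (x ∷ xs) (suc i) = lookup? xs i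

eval : ℕ → Code → List ℕ → Maybe ℕ
evalList : ℕ → List Code → List ℕ → Maybe (List ℕ)
search : ℕ → Code → List ℕ → ℕ → ℕ → Maybe ℕ

eval zero       c       xs           = nothing
eval (suc fuel) Z       xs           = just 0
eval (suc fuel) S       []           = nothing
eval (suc fuel) S       (x ∷ xs)     = just (suc x)
eval (suc fuel) (P i)   xs           = lookup? xs i
eval (suc fuel) (C g gs) xs          = evalList fuel gs xs >>= eval fuel g
eval (suc fuel) (R g h) []           = nothing
eval (suc fuel) (R g h) (zero ∷ xs)  = eval fuel g xs
eval (suc fuel) (R g h) (suc n ∷ xs) = eval fuel (R g h) (n ∷ xs) >>= λ r → eval fuel h (n ∷ r ∷ xs)
eval (suc fuel) (M g)   xs           = search fuel g xs 0 fuel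

evalList zero       gs       xs = nothing
evalList (suc fuel) []       xs = just []
evalList (suc fuel) (g ∷ gs) xs =
  eval fuel g xs >>= λ y → evalList fuel gs xs >>= λ ys → just (y ∷ ys)

search fuel g xs z zero = nothing
search fuel g xs z (suc c) with eval fuel g (z ∷ xs)
... | nothing      = nothing
... | just zero    = just z
... | just (suc _) = search fuel g xs (suc z) c

>>=-just⁻ : ∀ {A B : Set} (m : Maybe A) {k : A → Maybe B} {y} →
  (m >>= k) ≡ just y → Σ A λ a → m ≡ just a × k a ≡ just y
>>=-just⁻ (just a) eq = a , refl , eq

lookup?-sound : ∀ xs i {y} → lookup? xs i ≡ just y → lookupL xs i y
lookup?-sound (x ∷ xs) zero    refl = refl
lookup?-sound (x ∷ xs) (suc i) eq   = lookup?-sound xs i eq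

eval-sound : ∀ fuel c xs {y} → eval fuel c xs ≡ just y → Eval c xs y
evalList-sound : ∀ fuel gs xs {ys} → evalList fuel gs xs ≡ just ys → EvalL gs xs ys
search-sound : ∀ fuel g xs z c {y} → search fuel g xs z c ≡ just y →
  Eval g (y ∷ xs) 0 × (∀ w → z ≤ w → w < y → Σ ℕ λ v → Eval g (w ∷ xs) (suc v))

eval-sound (suc fuel) Z xs refl = eZ
eval-sound (suc fuel) S (x ∷ xs) refl = eS
eval-sound (suc fuel) (P i) xs eq = eP (lookup?-sound xs i eq)
eval-sound (suc fuel) (C g gs) xs eq with >>=-just⁻ (evalList fuel gs xs) eq
... | ys , eqs , eq′ = eC (evalList-sound fuel gs xs eqs) (eval-sound fuel g ys eq′)
eval-sound (suc fuel) (R g h) (zero ∷ xs) eq = eR0 (eval-sound fuel g xs eq)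
eval-sound (suc fuel) (R g h) (suc n ∷ xs) eq with >>=-just⁻ (eval fuel (R g h) (n ∷ xs)) eq
... | r , eqr , eq′ = eRS (eval-sound fuel (R g h) (n ∷ xs) eqr) (eval-sound fuel h (n ∷ r ∷ xs) eq′)
eval-sound (suc fuel) (M g) xs eq with search-sound fuel g xs 0 fuel eq
... | root , below = eM root (λ w → below w z≤n)

evalList-sound (suc fuel) [] xs refl = []
evalList-sound (suc fuel) (g ∷ gs) xs eq with >>=-just⁻ (eval fuel g xs) eq
... | y , eqy , eq′ with >>=-just⁻ (evalList fuel gs xs) eq′
... | ys , eqs , refl = eval-sound fuel g xs eqy ∷ evalList-sound fuel gs xs eqs

search-sound fuel g xs z (suc c) eq with eval fuel g (z ∷ xs) in ev
search-sound fuel g xs z (suc c) refl | just zero =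
  eval-sound fuel g (z ∷ xs) ev , λ w z≤w w<z → contradiction (≤-<-trans z≤w w<z) (<-irrefl refl)
search-sound fuel g xs z (suc c) {y} eq | just (suc v) with search-sound fuel g xs (suc z) c eq
... | root , below = root , earlier
  where
  earlier : ∀ w → z ≤ w → w < y → Σ ℕ λ v → Eval g (w ∷ xs) (suc v)
  earlier w z≤w w<y with m≤n⇒m<n∨m≡n z≤w
  ... | inj₁ z<w  = below w z<w w<y
  ... | inj₂ refl = v , eval-sound fuel g (z ∷ xs) ev

eval-suc : ∀ fuel c xs {y} → eval fuel c xs ≡ just y → eval (suc fuel) c xs ≡ just y
evalList-suc : ∀ fuel gs xs {ys} → evalList fuel gs xs ≡ just ys → evalList (suc fuel) gs xs ≡ just ys
search-suc : ∀ fuel g xs z c {y} → search fuel g xs z c ≡ just y → search (suc fuel) g xs z (suc c) ≡ just y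

eval-suc (suc fuel) Z xs eq = eq
eval-suc (suc fuel) S (x ∷ xs) eq = eq
eval-suc (suc fuel) (P i) xs eq = eq
eval-suc (suc fuel) (C g gs) xs eq with >>=-just⁻ (evalList fuel gs xs) eq
... | ys , eqs , eq′ rewrite evalList-suc fuel gs xs eqs = eval-suc fuel g ys eq′
eval-suc (suc fuel) (R g h) (zero ∷ xs) eq = eval-suc fuel g xs eq
eval-suc (suc fuel) (R g h) (suc n ∷ xs) eq with >>=-just⁻ (eval fuel (R g h) (n ∷ xs)) eq
... | r , eqr , eq′ rewrite eval-suc fuel (R g h) (n ∷ xs) eqr = eval-suc fuel h (n ∷ r ∷ xs) eq′
eval-suc (suc fuel) (M g) xs eq = search-suc fuel g xs 0 fuel eq

evalList-suc (suc fuel) [] xs eq = eq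
evalList-suc (suc fuel) (g ∷ gs) xs eq with >>=-just⁻ (eval fuel g xs) eq
... | y , eqy , eq′ with >>=-just⁻ (evalList fuel gs xs) eq′
... | ys , eqs , refl rewrite eval-suc fuel g xs eqy | evalList-suc fuel gs xs eqs = refl

search-suc fuel g xs z (suc c) eq with eval fuel g (z ∷ xs) in ev
search-suc fuel g xs z (suc c) refl | just zero rewrite eval-suc fuel g (z ∷ xs) ev = refl
search-suc fuel g xs z (suc c) eq | just (suc v) rewrite eval-suc fuel g (z ∷ xs) ev =
  search-suc fuel g xs (suc z) c eq

search-complete : ∀ fuel g xs {y} → eval fuel g (y ∷ xs) ≡ just 0 →
  (∀ w → w < y → Σ ℕ λ v → eval fuel g (w ∷ xs) ≡ just (suc v)) →
  ∀ z c → z ≤ y → y < z + c → search fuel g xs z c ≡ just y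
search-complete fuel g xs {y} root below z zero z≤y y<z+0 =
  contradiction (≤-<-trans z≤y (subst (y <_) (+-identityʳ z) y<z+0)) (<-irrefl refl)
search-complete fuel g xs {y} root below z (suc c) z≤y y<z+c with m≤n⇒m<n∨m≡n z≤y
... | inj₂ refl rewrite root = refl
... | inj₁ z<y with below z z<y
... | v , ev rewrite ev = search-complete fuel g xs root below (suc z) c z<y (subst (y <_) (+-suc z c) y<z+c)

tagOf : Code → ℕ
tagOf Z       = 0
tagOf S       = 1
tagOf (P _)   = 2
tagOf (C _ _) = 3
tagOf (R _ _) = 4
tagOf (M _)   = 5

decodeTag : ℕ → ℕ → ℕ → Code
decodeTag df 0 m = Z
decodeTag df 1 m = S
decodeTag df 2 m = P m
decodeTag df 3 m = C (decodeCodeF df (proj₁ (unpair m))) (decodeCodesF df (proj₂ (unpair m)))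
decodeTag df 4 m = R (decodeCodeF df (proj₁ (unpair m))) (decodeCodeF df (proj₂ (unpair m)))
decodeTag df 5 m = M (decodeCodeF df m)
decodeTag df (suc (suc (suc (suc (suc (suc _)))))) m = Z

decodeCodeF-IsPair : ∀ df {e t m} → IsPair e t m → decodeCodeF (suc df) e ≡ decodeTag df t m
decodeCodeF-IsPair df {e} {t} {m} pr with unpair e | IsPair⇒unpair {e} {t} {m} pr
... | .(t , m) | refl with t
... | 0 = refl
... | 1 = refl
... | 2 = refl
... | 3 = refl
... | 4 = refl
... | 5 = refl
... | suc (suc (suc (suc (suc (suc _))))) = refl

decodeCodeF-Z⁻ : ∀ df e → decodeCodeF df e ≡ Z →
  df ≡ 0 ⊎ (proj₁ (unpair e) ≡ 0 ⊎ 5 < proj₁ (unpair e))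
decodeCodeF-Z⁻ zero e _ = inj₁ refl
decodeCodeF-Z⁻ (suc df) e h with unpair e
... | 0 , _ = inj₂ (inj₁ refl)
... | suc (suc (suc (suc (suc (suc _))))) , _ = inj₂ (inj₂ (s≤s (s≤s (s≤s (s≤s (s≤s (s≤s z≤n)))))))

decodeCodeF-≢Z⁻ : ∀ df e {c} → decodeCodeF df e ≡ c → c ≢ Z →
  Σ ℕ λ df′ → df ≡ suc df′ × IsPair e (tagOf c) (proj₂ (unpair e)) ×
              decodeTag df′ (tagOf c) (proj₂ (unpair e)) ≡ c
decodeCodeF-≢Z⁻ zero e refl c≢Z = contradiction refl c≢Z
decodeCodeF-≢Z⁻ (suc df) e refl c≢Z with unpair e in eq
... | 0 , m = contradiction refl c≢Z
... | 1 , m = df , refl , unpair⇒IsPair e eq , refl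
... | 2 , m = df , refl , unpair⇒IsPair e eq , refl
... | 3 , m = df , refl , unpair⇒IsPair e eq , refl
... | 4 , m = df , refl , unpair⇒IsPair e eq , refl
... | 5 , m = df , refl , unpair⇒IsPair e eq , refl
... | suc (suc (suc (suc (suc (suc _))))) , m = contradiction refl c≢Z

decodeCodesF-[]⁻ : ∀ df b → decodeCodesF df b ≡ [] → df ≡ 0 ⊎ b ≡ 0
decodeCodesF-[]⁻ zero    b    _ = inj₁ refl
decodeCodesF-[]⁻ (suc _) zero _ = inj₂ refl

decodeCodesF-∷⁻ : ∀ df b {g gs} → decodeCodesF df b ≡ g ∷ gs →
  Σ ℕ λ df′ → Σ ℕ λ b′ → df ≡ suc df′ × b ≡ suc b′ ×
    decodeCodeF df′ (proj₁ (unpair b′)) ≡ g × decodeCodesF df′ (proj₂ (unpair b′)) ≡ gs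
decodeCodesF-∷⁻ (suc df) (suc b) refl = df , b , refl , refl , refl , refl

Table : Set₁
Table = ℕ → ℕ → ℕ → ℕ → ℕ → Set

-- T ef df e n y reads "with evaluation fuel ef, the code decodeCodeF df e maps the
-- arguments decodeList n to y"; TL likewise for decodeCodesF df b and results decodeList ys.
-- The fields are the clauses of eval, with every pairing spelled as an IsPair equation,
-- so that each of them is an arithmetical statement about the tables.
record EvalRules (T TL : Table) : Set where
  field
    fuel-mono   : ∀ ef df e n y → T ef df e n y → T (suc ef) df e n y
    fuel-monoL  : ∀ ef df b n ys → TL ef df b n ys → TL (suc ef) df b n ys
    Z-unfueled  : ∀ ef e n → T (suc ef) 0 e n 0
    Z-rule      : ∀ ef df e t m n → IsPair e t m → (t ≡ 0) ⊎ (5 < t) → T (suc ef) df e n 0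
    S-rule      : ∀ ef df e m p x q → IsPair e 1 m → IsPair p x q →
                  T (suc ef) (suc df) e (suc p) (suc x)
    P-zero-rule : ∀ ef df e p x q → IsPair e 2 0 → IsPair p x q → T (suc ef) (suc df) e (suc p) x
    P-suc-rule  : ∀ ef df e i e′ p x q y → IsPair e 2 (suc i) → IsPair e′ 2 i → IsPair p x q →
                  T ef (suc df) e′ q y → T (suc ef) (suc df) e (suc p) y
    C-rule      : ∀ ef df e m a b n ys y → IsPair e 3 m → IsPair m a b → TL ef df b n ys →
                  T ef df a ys y → T (suc ef) (suc df) e n y
    R-zero-rule : ∀ ef df e m a b p q y → IsPair e 4 m → IsPair m a b → IsPair p 0 q →
                  T ef df a q y → T (suc ef) (suc df) e (suc p) y
    R-suc-rule  : ∀ ef df e m a b p j q p₁ r p₂ p₃ y → IsPair e 4 m → IsPair m a b →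
                  IsPair p (suc j) q → IsPair p₁ j q → IsPair p₂ r q → IsPair p₃ j (suc p₂) →
                  T ef (suc df) e (suc p₁) r → T ef df b (suc p₃) y → T (suc ef) (suc df) e (suc p) y
    M-rule      : ∀ ef df e a n y p → IsPair e 5 a → IsPair p y n → T ef df a (suc p) 0 →
                  (∀ z → z < y → Σ ℕ λ v → Σ ℕ λ p′ → IsPair p′ z n × T ef df a (suc p′) (suc v)) →
                  y < ef → T (suc ef) (suc df) e n y
    nil-rule    : ∀ ef df b n → (df ≡ 0) ⊎ (b ≡ 0) → TL (suc ef) df b n 0
    cons-rule   : ∀ ef df b a b′ n y ys p → IsPair b a b′ → T ef df a n y → TL ef df b′ n ys →
                  IsPair p y ys → TL (suc ef) (suc df) (suc b) n (suc p)

≤-lift : ∀ (Q : ℕ → Set) → (∀ {k} → Q k → Q (suc k)) → ∀ {m n} → m ≤ n → Q m → Q n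
≤-lift Q step m≤n = go (≤⇒≤′ m≤n)
  where
  go : ∀ {m n} → m ≤′ n → Q m → Q n
  go ≤′-refl        q = q
  go (≤′-step m≤′n) q = step (go m≤′n q)

uniform-bound : ∀ (Q : ℕ → ℕ → Set) → (∀ {E E′ z} → E ≤ E′ → Q E z → Q E′ z) →
  ∀ y → (∀ z → z < y → Σ ℕ λ E → Q E z) → Σ ℕ λ E → ∀ z → z < y → Q E z
uniform-bound Q mono zero    bound = 0 , λ _ ()
uniform-bound Q mono (suc y) bound
  with uniform-bound Q mono y (λ z z<y → bound z (m<n⇒m<1+n z<y)) | bound y ≤-refl
... | E , below | E′ , at = E ⊔ E′ , bounded
  where
  bounded : ∀ z → z < suc y → Q (E ⊔ E′) z
  bounded z z<1+y with m<1+n⇒m<n∨m≡n z<1+y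
  ... | inj₁ z<y  = mono (m≤m⊔n E E′) (below z z<y)
  ... | inj₂ refl = mono (m≤n⊔m E E′) at

module _ {T TL : Table} (rules : EvalRules T TL) where
  open EvalRules rules

  T-≤ : ∀ {ef ef′ df e n y} → ef ≤ ef′ → T ef df e n y → T ef′ df e n y
  T-≤ {df = df} {e} {n} {y} = ≤-lift (λ ef → T ef df e n y) (fuel-mono _ df e n y)

  TL-≤ : ∀ {ef ef′ df b n ys} → ef ≤ ef′ → TL ef df b n ys → TL ef′ df b n ys
  TL-≤ {df = df} {b} {n} {ys} = ≤-lift (λ ef → TL ef df b n ys) (fuel-monoL _ df b n ys)

  lookup⇒table : ∀ df i e n {xs y} → IsPair e 2 i → decodeList n ≡ xs → lookupL xs i y →
    Σ ℕ λ ef → T ef (suc df) e n y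
  lookup⇒table df zero e n {x ∷ xs} pe dn refl with decodeList-∷⁻ n dn
  ... | p , q , refl , pr , _ = 1 , P-zero-rule 0 df e p x q pe pr
  lookup⇒table df (suc i) e n {x ∷ xs} pe dn lk with decodeList-∷⁻ n dn
  ... | p , q , refl , pr , dq with lookup⇒table df i (pair 2 i) q (pair-IsPair 2 i) dq lk
  ... | ef , t = suc ef , P-suc-rule ef df e i (pair 2 i) p x q _ pe (pair-IsPair 2 i) pr t

  M⇒table : ∀ df e a n y {ef₀} → IsPair e 5 a → T ef₀ df a (suc (pair y n)) 0 →
    (∀ z → z < y → Σ ℕ λ ef → Σ ℕ λ v → T ef df a (suc (pair z n)) (suc v)) →
    Σ ℕ λ ef → T ef (suc df) e n y
  M⇒table df e a n y {ef₀} pe root below =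
    suc F , M-rule F df e a n y (pair y n) pe (pair-IsPair y n) (T-≤ ef₀≤F root) earlier y<F
    where
    bound : Σ ℕ λ E → ∀ z → z < y → Σ ℕ λ v → T E df a (suc (pair z n)) (suc v)
    bound = uniform-bound (λ ef z → Σ ℕ λ v → T ef df a (suc (pair z n)) (suc v))
                          (λ le (v , t) → v , T-≤ le t) y below
    E F : ℕ
    E = proj₁ bound
    F = (ef₀ ⊔ E) ⊔ suc y
    ef₀≤F : ef₀ ≤ F
    ef₀≤F = ≤-trans (m≤m⊔n ef₀ E) (m≤m⊔n _ (suc y))
    E≤F : E ≤ F
    E≤F = ≤-trans (m≤n⊔m ef₀ E) (m≤m⊔n _ (suc y))
    y<F : y < F
    y<F = m≤n⊔m (ef₀ ⊔ E) (suc y)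
    earlier : ∀ z → z < y → Σ ℕ λ v → Σ ℕ λ p → IsPair p z n × T F df a (suc p) (suc v)
    earlier z z<y = let (v , t) = proj₂ bound z z<y in v , pair z n , pair-IsPair z n , T-≤ E≤F t

  Eval⇒table : ∀ {c xs y} → Eval c xs y → ∀ df e n → decodeCodeF df e ≡ c → decodeList n ≡ xs →
    Σ ℕ λ ef → T ef df e n y
  EvalL⇒table : ∀ {gs xs ys} → EvalL gs xs ys → ∀ df b n → decodeCodesF df b ≡ gs → decodeList n ≡ xs →
    Σ ℕ λ ef → Σ ℕ λ nys → decodeList nys ≡ ys × TL ef df b n nys

  Eval⇒table eZ df e n h _ with decodeCodeF-Z⁻ df e h
  ... | inj₁ refl = 1 , Z-unfueled 0 e n
  ... | inj₂ tag  = 1 , Z-rule 0 df e _ (proj₂ (unpair e)) n (unpair-IsPair e) tag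
  Eval⇒table (eS {x}) df e n h dn with decodeCodeF-≢Z⁻ df e h (λ ()) | decodeList-∷⁻ n dn
  ... | df′ , refl , pe , _ | p , q , refl , pr , _ = 1 , S-rule 0 df′ e (proj₂ (unpair e)) p x q pe pr
  Eval⇒table (eP {i} lk) df e n h dn with decodeCodeF-≢Z⁻ df e h (λ ())
  ... | df′ , refl , pe , refl = lookup⇒table df′ i e n pe dn lk
  Eval⇒table (eC dL d) df e n h dn with decodeCodeF-≢Z⁻ df e h (λ ())
  ... | df′ , refl , pe , refl with EvalL⇒table dL df′ _ n refl dn
  ... | ef₁ , nys , dys , tl with Eval⇒table d df′ _ nys refl dys
  ... | ef₂ , t = suc (ef₁ ⊔ ef₂) ,
        C-rule (ef₁ ⊔ ef₂) df′ e m a b n nys _ pe (unpair-IsPair m)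
          (TL-≤ (m≤m⊔n ef₁ ef₂) tl) (T-≤ (m≤n⊔m ef₁ ef₂) t)
    where
    m = proj₂ (unpair e)
    a = proj₁ (unpair m)
    b = proj₂ (unpair m)
  Eval⇒table (eR0 d) df e n h dn with decodeCodeF-≢Z⁻ df e h (λ ()) | decodeList-∷⁻ n dn
  ... | df′ , refl , pe , refl | p , q , refl , pr , dq with Eval⇒table d df′ _ q refl dq
  ... | ef , t = suc ef , R-zero-rule ef df′ e m a b p q _ pe (unpair-IsPair m) pr t
    where
    m = proj₂ (unpair e)
    a = proj₁ (unpair m)
    b = proj₂ (unpair m)
  Eval⇒table (eRS {n = j} {r = r} d₁ d₂) df e n h dn with decodeCodeF-≢Z⁻ df e h (λ ())
  ... | df′ , refl , pe , refl with decodeList-∷⁻ n dn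
  ... | p , q , refl , pr , dq
    with Eval⇒table d₁ (suc df′) e (suc (pair j q)) h (decodeList-cons j dq)
       | Eval⇒table d₂ df′ _ (suc (pair j (suc (pair r q)))) refl
           (decodeList-cons j (decodeList-cons r dq))
  ... | ef₁ , t₁ | ef₂ , t₂ = suc (ef₁ ⊔ ef₂) ,
        R-suc-rule (ef₁ ⊔ ef₂) df′ e m a b p j q (pair j q) r (pair r q) (pair j (suc (pair r q))) _
          pe (unpair-IsPair m) pr (pair-IsPair j q) (pair-IsPair r q) (pair-IsPair j _)
          (T-≤ (m≤m⊔n ef₁ ef₂) t₁) (T-≤ (m≤n⊔m ef₁ ef₂) t₂)
    where
    m = proj₂ (unpair e)
    a = proj₁ (unpair m)
    b = proj₂ (unpair m)
  Eval⇒table (eM {y = y} root below) df e n h dn with decodeCodeF-≢Z⁻ df e h (λ ())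
  ... | df′ , refl , pe , refl =
    M⇒table df′ e _ n y pe (proj₂ (Eval⇒table root df′ _ (suc (pair y n)) refl (decodeList-cons y dn)))
      earlier
    where
    earlier : ∀ z → z < y → Σ ℕ λ ef → Σ ℕ λ v → T ef df′ (proj₂ (unpair e)) (suc (pair z n)) (suc v)
    earlier z z<y with below z z<y
    ... | v , dz with Eval⇒table dz df′ _ (suc (pair z n)) refl (decodeList-cons z dn)
    ... | ef , t = ef , v , t

  EvalL⇒table [] df b n h _ = 1 , 0 , refl , nil-rule 0 df b n (decodeCodesF-[]⁻ df b h)
  EvalL⇒table (_∷_ {y = y} d dL) df b n h dn with decodeCodesF-∷⁻ df b h
  ... | df′ , b′ , refl , refl , hg , hgs with Eval⇒table d df′ _ n hg dn | EvalL⇒table dL df′ _ n hgs dn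
  ... | ef₁ , t | ef₂ , nys , dys , tl = suc (ef₁ ⊔ ef₂) , suc (pair y nys) ,
        decodeList-cons y dys ,
        cons-rule (ef₁ ⊔ ef₂) df′ b′ (proj₁ (unpair b′)) (proj₂ (unpair b′)) n y nys _ (unpair-IsPair b′)
          (T-≤ (m≤m⊔n ef₁ ef₂) t) (TL-≤ (m≤n⊔m ef₁ ef₂) tl) (pair-IsPair y nys)

open EvalRules

EvalTable : Table
EvalTable ef df e n y = eval ef (decodeCodeF df e) (decodeList n) ≡ just y

EvalListTable : Table
EvalListTable ef df b n ys = evalList ef (decodeCodesF df b) (decodeList n) ≡ just (decodeList ys)

decodeTag-Z : ∀ df t m → (t ≡ 0) ⊎ (5 < t) → decodeTag df t m ≡ Z
decodeTag-Z df 0 m _ = refl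
decodeTag-Z df 1 m (inj₂ (s≤s ()))
decodeTag-Z df 2 m (inj₂ (s≤s (s≤s ())))
decodeTag-Z df 3 m (inj₂ (s≤s (s≤s (s≤s ()))))
decodeTag-Z df 4 m (inj₂ (s≤s (s≤s (s≤s (s≤s ())))))
decodeTag-Z df 5 m (inj₂ (s≤s (s≤s (s≤s (s≤s (s≤s ()))))))
decodeTag-Z df (suc (suc (suc (suc (suc (suc _)))))) m _ = refl

>>=-just : ∀ {A B : Set} {m : Maybe A} {k : A → Maybe B} {a y} →
  m ≡ just a → k a ≡ just y → (m >>= k) ≡ just y
>>=-just refl eq = eq

eval-P⁻ : ∀ ef i xs {y} → eval ef (P i) xs ≡ just y → lookup? xs i ≡ just y
eval-P⁻ (suc ef) i xs eq = eq

decodeCodeF-C : ∀ df {e m a b} → IsPair e 3 m → IsPair m a b →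
  decodeCodeF (suc df) e ≡ C (decodeCodeF df a) (decodeCodesF df b)
decodeCodeF-C df {e} {m} {a} {b} pe pm = trans (decodeCodeF-IsPair df {e} {3} {m} pe)
  (cong (λ (a , b) → C (decodeCodeF df a) (decodeCodesF df b)) (IsPair⇒unpair {m} {a} {b} pm))

decodeCodeF-R : ∀ df {e m a b} → IsPair e 4 m → IsPair m a b →
  decodeCodeF (suc df) e ≡ R (decodeCodeF df a) (decodeCodeF df b)
decodeCodeF-R df {e} {m} {a} {b} pe pm = trans (decodeCodeF-IsPair df {e} {4} {m} pe)
  (cong (λ (a , b) → R (decodeCodeF df a) (decodeCodeF df b)) (IsPair⇒unpair {m} {a} {b} pm))

decodeCodesF-IsPair : ∀ df {b a b′} → IsPair b a b′ →
  decodeCodesF (suc df) (suc b) ≡ decodeCodeF df a ∷ decodeCodesF df b′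
decodeCodesF-IsPair df {b} {a} {b′} pb =
  cong (λ (a , b′) → decodeCodeF df a ∷ decodeCodesF df b′) (IsPair⇒unpair {b} {a} {b′} pb)

EvalTable-intro : ∀ ef df e n {y c xs} → decodeCodeF df e ≡ c → decodeList n ≡ xs →
  eval ef c xs ≡ just y → EvalTable ef df e n y
EvalTable-intro ef df e n refl refl t = t

EvalTable-elim : ∀ ef df e n {y c xs} → EvalTable ef df e n y →
  decodeCodeF df e ≡ c → decodeList n ≡ xs → eval ef c xs ≡ just y
EvalTable-elim ef df e n t refl refl = t

evalRules : EvalRules EvalTable EvalListTable
evalRules .fuel-mono ef df e n y = eval-suc ef _ _
evalRules .fuel-monoL ef df b n ys = evalList-suc ef _ _
evalRules .Z-unfueled ef e n = refl
evalRules .Z-rule ef zero e t m n pe tag = refl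
evalRules .Z-rule ef (suc df) e t m n pe tag = EvalTable-intro (suc ef) (suc df) e n
  (trans (decodeCodeF-IsPair df {e} {t} {m} pe) (decodeTag-Z df t m tag)) refl refl
evalRules .S-rule ef df e m p x q pe pr = EvalTable-intro (suc ef) (suc df) e (suc p)
  (decodeCodeF-IsPair df {e} {1} {m} pe) (decodeList-IsPair {p} {x} {q} pr) refl
evalRules .P-zero-rule ef df e p x q pe pr = EvalTable-intro (suc ef) (suc df) e (suc p)
  (decodeCodeF-IsPair df {e} {2} {0} pe) (decodeList-IsPair {p} {x} {q} pr) refl
evalRules .P-suc-rule ef df e i e′ p x q y pe pe′ pr t = EvalTable-intro (suc ef) (suc df) e (suc p)
  (decodeCodeF-IsPair df {e} {2} {suc i} pe) (decodeList-IsPair {p} {x} {q} pr)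
  (eval-P⁻ ef i _ (EvalTable-elim ef (suc df) e′ q t (decodeCodeF-IsPair df {e′} {2} {i} pe′) refl))
evalRules .C-rule ef df e m a b n ys y pe pm tl t = EvalTable-intro (suc ef) (suc df) e n
  (decodeCodeF-C df {e} {m} {a} {b} pe pm) refl (>>=-just tl t)
evalRules .R-zero-rule ef df e m a b p q y pe pm pr t = EvalTable-intro (suc ef) (suc df) e (suc p)
  (decodeCodeF-R df {e} {m} {a} {b} pe pm) (decodeList-IsPair {p} {0} {q} pr) t
evalRules .R-suc-rule ef df e m a b p j q p₁ r p₂ p₃ y pe pm pr pr₁ pr₂ pr₃ t₁ t₂ =
  EvalTable-intro (suc ef) (suc df) e (suc p) codeR (decodeList-IsPair {p} {suc j} {q} pr)
    (>>=-just (EvalTable-elim ef (suc df) e (suc p₁) t₁ codeR (decodeList-IsPair {p₁} {j} {q} pr₁))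
              (EvalTable-elim ef df b (suc p₃) t₂ refl
                (trans (decodeList-IsPair {p₃} {j} {suc p₂} pr₃)
                       (cong (j ∷_) (decodeList-IsPair {p₂} {r} {q} pr₂)))))
  where codeR = decodeCodeF-R df {e} {m} {a} {b} pe pm
evalRules .M-rule ef df e a n y p pe pr t₀ below y<ef = EvalTable-intro (suc ef) (suc df) e n
  (decodeCodeF-IsPair df {e} {5} {a} pe) refl
  (search-complete ef (decodeCodeF df a) (decodeList n) root earlier 0 ef z≤n y<ef)
  where
  root : eval ef (decodeCodeF df a) (y ∷ decodeList n) ≡ just 0
  root = EvalTable-elim ef df a (suc p) t₀ refl (decodeList-IsPair {p} {y} {n} pr)
  earlier : ∀ w → w < y → Σ ℕ λ v → eval ef (decodeCodeF df a) (w ∷ decodeList n) ≡ just (suc v)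
  earlier w w<y with below w w<y
  ... | v , p′ , pr′ , t = v , EvalTable-elim ef df a (suc p′) t refl (decodeList-IsPair {p′} {w} {n} pr′)
evalRules .nil-rule ef zero     b       n _ = refl
evalRules .nil-rule ef (suc df) zero    n _ = refl
evalRules .nil-rule ef (suc df) (suc b) n (inj₁ ())
evalRules .nil-rule ef (suc df) (suc b) n (inj₂ ())
evalRules .cons-rule ef df b a b′ n y ys p pb t tl pr =
  subst₂ (λ gs zs → evalList (suc ef) gs (decodeList n) ≡ just zs)
    (sym (decodeCodesF-IsPair df {b} {a} {b′} pb)) (sym (decodeList-IsPair {p} {y} {ys} pr))
    (>>=-just t (>>=-just tl refl))

EvalTable⇒InRE : ∀ ef e {p t m} → IsPair p t 0 → EvalTable ef e e (suc p) m → InRE e m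
EvalTable⇒InRE ef e {p} {t} {m} pr tabled =
  t , eval-sound ef _ _ (EvalTable-elim ef e e (suc p) tabled refl (decodeList-IsPair {p} {t} {0} pr))

module _ {T T′ TL TL′ : Table}
         (T⇔T′ : ∀ ef df e n y → T ef df e n y ⇔ T′ ef df e n y)
         (TL⇔TL′ : ∀ ef df b n ys → TL ef df b n ys ⇔ TL′ ef df b n ys) where

  private
    toT : ∀ {ef df e n y} → T ef df e n y → T′ ef df e n y
    toT = T⇔T′ _ _ _ _ _ .to
    fromT : ∀ {ef df e n y} → T′ ef df e n y → T ef df e n y
    fromT = T⇔T′ _ _ _ _ _ .from
    toTL : ∀ {ef df b n ys} → TL ef df b n ys → TL′ ef df b n ys
    toTL = TL⇔TL′ _ _ _ _ _ .to
    fromTL : ∀ {ef df b n ys} → TL′ ef df b n ys → TL ef df b n ys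
    fromTL = TL⇔TL′ _ _ _ _ _ .from

  EvalRules-resp : EvalRules T TL → EvalRules T′ TL′
  EvalRules-resp rules .fuel-mono ef df e n y t = toT (rules .fuel-mono ef df e n y (fromT t))
  EvalRules-resp rules .fuel-monoL ef df b n ys t = toTL (rules .fuel-monoL ef df b n ys (fromTL t))
  EvalRules-resp rules .Z-unfueled ef e n = toT (rules .Z-unfueled ef e n)
  EvalRules-resp rules .Z-rule ef df e t m n pe tag = toT (rules .Z-rule ef df e t m n pe tag)
  EvalRules-resp rules .S-rule ef df e m p x q pe pr = toT (rules .S-rule ef df e m p x q pe pr)
  EvalRules-resp rules .P-zero-rule ef df e p x q pe pr = toT (rules .P-zero-rule ef df e p x q pe pr)
  EvalRules-resp rules .P-suc-rule ef df e i e′ p x q y pe pe′ pr t =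
    toT (rules .P-suc-rule ef df e i e′ p x q y pe pe′ pr (fromT t))
  EvalRules-resp rules .C-rule ef df e m a b n ys y pe pm tl t =
    toT (rules .C-rule ef df e m a b n ys y pe pm (fromTL tl) (fromT t))
  EvalRules-resp rules .R-zero-rule ef df e m a b p q y pe pm pr t =
    toT (rules .R-zero-rule ef df e m a b p q y pe pm pr (fromT t))
  EvalRules-resp rules .R-suc-rule ef df e m a b p j q p₁ r p₂ p₃ y pe pm pr pr₁ pr₂ pr₃ t₁ t₂ =
    toT (rules .R-suc-rule ef df e m a b p j q p₁ r p₂ p₃ y pe pm pr pr₁ pr₂ pr₃ (fromT t₁) (fromT t₂))
  EvalRules-resp rules .M-rule ef df e a n y p pe pr t₀ below y<ef =
    toT (rules .M-rule ef df e a n y p pe pr (fromT t₀)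
      (λ z z<y → let (v , p′ , pr′ , t) = below z z<y in v , p′ , pr′ , fromT t) y<ef)
  EvalRules-resp rules .nil-rule ef df b n empty = toTL (rules .nil-rule ef df b n empty)
  EvalRules-resp rules .cons-rule ef df b a b′ n y ys p pb t tl pr =
    toTL (rules .cons-rule ef df b a b′ n y ys p pb (fromT t) (fromTL tl) pr)

tuple : List ℕ → ℕ
tuple []       = 0
tuple (a ∷ as) = twicePair a (tuple as)

Holds : (ℕ → Bool) → List ℕ → Set
Holds f vs = f (tuple vs) ≡ true

OracleTable : (ℕ → Bool) → ℕ → Table
OracleTable f tag ef df e n y = Holds f (tag ∷ ef ∷ df ∷ e ∷ n ∷ y ∷ [])

opaque
  untwicePair : ℕ → ℕ × ℕ
  untwicePair i = unpair ⌊ i /2⌋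

  untwicePair-twicePair : ∀ a b → untwicePair (twicePair a b) ≡ (a , b)
  untwicePair-twicePair a b = unpair-pair a b (begin
    pair a b                     ≡⟨ n≡⌊n+n/2⌋ (pair a b) ⟩
    ⌊ pair a b + pair a b /2⌋    ≡⟨ cong ⌊_/2⌋ (twicePair≡pair+pair a b) ⟨
    ⌊ twicePair a b /2⌋          ∎)
    where open ≡-Reasoning

component : ℕ → ℕ → ℕ
component zero    i = proj₁ (untwicePair i)
component (suc j) i = component j (proj₂ (untwicePair i))

component-tuple : ∀ j vs → component j (tuple vs) ≡ fromMaybe 0 (lookup? vs j)
component-tuple zero    []       = cong proj₁ (untwicePair-twicePair 0 0)
component-tuple (suc j) []       =
  trans (cong (component j ∘ proj₂) (untwicePair-twicePair 0 0)) (component-tuple j [])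
component-tuple zero    (a ∷ as) = cong proj₁ (untwicePair-twicePair a (tuple as))
component-tuple (suc j) (a ∷ as) =
  trans (cong (component j ∘ proj₂) (untwicePair-twicePair a (tuple as))) (component-tuple j as)

does≡true⇔ : ∀ {A : Set} (a? : Dec A) → does a? ≡ true ⇔ A
does≡true⇔ (yes a) = mk⇔ (λ _ → a) (λ _ → refl)
does≡true⇔ (no ¬a) = mk⇔ (λ ()) (λ a → contradiction a ¬a)

infixr 4 _⊃_
infixr 5 _∧_ _∨_
infix 30 #_

_⊃_ : Formula → Formula → Formula
_⊃_ = _⇒ᶠ_

_∧_ : Formula → Formula → Formula
_∧_ = _∧ᶠ_

_∨_ : Formula → Formula → Formula
_∨_ = _∨ᶠ_

#_ : ℕ → Term
# i = var i

numeral : ℕ → Term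
numeral zero    = zer
numeral (suc n) = succ (numeral n)

∀ⁿ : ℕ → Formula → Formula
∀ⁿ zero    φ = φ
∀ⁿ (suc n) φ = ∀ᶠ (∀ⁿ n φ)

twicePairᵗ : Term → Term → Term
twicePairᵗ a b = ((a +ₜ b) *ₜ succ (a +ₜ b)) +ₜ (a +ₜ a)

IsPairᶠ : Term → Term → Term → Formula
IsPairᶠ z a b = (z +ₜ z) ≐ twicePairᵗ a b

tupleᵗ : List Term → Term
tupleᵗ []       = zer
tupleᵗ (t ∷ ts) = twicePairᵗ t (tupleᵗ ts)

atomᶠ : List Term → Formula
atomᶠ ts = orc (tupleᵗ ts)

Tᶠ : Term → Term → Term → Term → Term → Formula
Tᶠ ef df e n y = atomᶠ (numeral 2 ∷ ef ∷ df ∷ e ∷ n ∷ y ∷ [])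

TLᶠ : Term → Term → Term → Term → Term → Formula
TLᶠ ef df b n ys = atomᶠ (numeral 3 ∷ ef ∷ df ∷ b ∷ n ∷ ys ∷ [])

rulesᶠ : Formula
rulesᶠ =
  ∀ⁿ 5 (Tᶠ (# 4) (# 3) (# 2) (# 1) (# 0) ⊃ Tᶠ (succ (# 4)) (# 3) (# 2) (# 1) (# 0)) ∧
  ∀ⁿ 5 (TLᶠ (# 4) (# 3) (# 2) (# 1) (# 0) ⊃ TLᶠ (succ (# 4)) (# 3) (# 2) (# 1) (# 0)) ∧
  ∀ⁿ 3 (Tᶠ (succ (# 2)) zer (# 1) (# 0) zer) ∧
  ∀ⁿ 6 (IsPairᶠ (# 3) (# 2) (# 1) ⊃ ((# 2 ≐ zer) ∨ (numeral 5 ≺ # 2)) ⊃ Tᶠ (succ (# 5)) (# 4) (# 3) (# 0) zer) ∧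
  ∀ⁿ 7 (IsPairᶠ (# 4) (numeral 1) (# 3) ⊃ IsPairᶠ (# 2) (# 1) (# 0) ⊃
        Tᶠ (succ (# 6)) (succ (# 5)) (# 4) (succ (# 2)) (succ (# 1))) ∧
  ∀ⁿ 6 (IsPairᶠ (# 3) (numeral 2) zer ⊃ IsPairᶠ (# 2) (# 1) (# 0) ⊃
        Tᶠ (succ (# 5)) (succ (# 4)) (# 3) (succ (# 2)) (# 1)) ∧
  ∀ⁿ 9 (IsPairᶠ (# 6) (numeral 2) (succ (# 5)) ⊃ IsPairᶠ (# 4) (numeral 2) (# 5) ⊃ IsPairᶠ (# 3) (# 2) (# 1) ⊃
        Tᶠ (# 8) (succ (# 7)) (# 4) (# 1) (# 0) ⊃ Tᶠ (succ (# 8)) (succ (# 7)) (# 6) (succ (# 3)) (# 0)) ∧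
  ∀ⁿ 9 (IsPairᶠ (# 6) (numeral 3) (# 5) ⊃ IsPairᶠ (# 5) (# 4) (# 3) ⊃ TLᶠ (# 8) (# 7) (# 3) (# 2) (# 1) ⊃
        Tᶠ (# 8) (# 7) (# 4) (# 1) (# 0) ⊃ Tᶠ (succ (# 8)) (succ (# 7)) (# 6) (# 2) (# 0)) ∧
  ∀ⁿ 9 (IsPairᶠ (# 6) (numeral 4) (# 5) ⊃ IsPairᶠ (# 5) (# 4) (# 3) ⊃ IsPairᶠ (# 2) zer (# 1) ⊃
        Tᶠ (# 8) (# 7) (# 4) (# 1) (# 0) ⊃ Tᶠ (succ (# 8)) (succ (# 7)) (# 6) (succ (# 2)) (# 0)) ∧
  ∀ⁿ 14 (IsPairᶠ (# 11) (numeral 4) (# 10) ⊃ IsPairᶠ (# 10) (# 9) (# 8) ⊃ IsPairᶠ (# 7) (succ (# 6)) (# 5) ⊃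
         IsPairᶠ (# 4) (# 6) (# 5) ⊃ IsPairᶠ (# 2) (# 3) (# 5) ⊃ IsPairᶠ (# 1) (# 6) (succ (# 2)) ⊃
         Tᶠ (# 13) (succ (# 12)) (# 11) (succ (# 4)) (# 3) ⊃ Tᶠ (# 13) (# 12) (# 8) (succ (# 1)) (# 0) ⊃
         Tᶠ (succ (# 13)) (succ (# 12)) (# 11) (succ (# 7)) (# 0)) ∧
  ∀ⁿ 7 (IsPairᶠ (# 4) (numeral 5) (# 3) ⊃ IsPairᶠ (# 0) (# 1) (# 2) ⊃ Tᶠ (# 6) (# 5) (# 3) (succ (# 0)) zer ⊃
        ∀ᶠ ((# 0 ≺ # 2) ⊃ ∃ᶠ (∃ᶠ (IsPairᶠ (# 0) (# 2) (# 5) ∧ Tᶠ (# 9) (# 8) (# 6) (succ (# 0)) (succ (# 1))))) ⊃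
        (# 1 ≺ # 6) ⊃ Tᶠ (succ (# 6)) (succ (# 5)) (# 4) (# 2) (# 1)) ∧
  ∀ⁿ 4 (((# 2 ≐ zer) ∨ (# 1 ≐ zer)) ⊃ TLᶠ (succ (# 3)) (# 2) (# 1) (# 0) zer) ∧
  ∀ⁿ 9 (IsPairᶠ (# 6) (# 5) (# 4) ⊃ Tᶠ (# 8) (# 7) (# 5) (# 3) (# 2) ⊃ TLᶠ (# 8) (# 7) (# 4) (# 3) (# 1) ⊃
        IsPairᶠ (# 0) (# 2) (# 1) ⊃ TLᶠ (succ (# 8)) (succ (# 7)) (succ (# 6)) (# 3) (succ (# 0)))

rulesᶠ-sound : ∀ f ρ → Sat f rulesᶠ ρ → EvalRules (OracleTable f 2) (OracleTable f 3)
rulesᶠ-sound f ρ (r₁ , r₂ , r₃ , r₄ , r₅ , r₆ , r₇ , r₈ , r₉ , r₁₀ , r₁₁ , r₁₂ , r₁₃) =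
  record { fuel-mono = r₁ ; fuel-monoL = r₂ ; Z-unfueled = r₃ ; Z-rule = r₄ ; S-rule = r₅
         ; P-zero-rule = r₆ ; P-suc-rule = r₇ ; C-rule = r₈ ; R-zero-rule = r₉ ; R-suc-rule = r₁₀
         ; M-rule = r₁₁ ; nil-rule = r₁₂ ; cons-rule = r₁₃ }

rulesᶠ-complete : ∀ f ρ → EvalRules (OracleTable f 2) (OracleTable f 3) → Sat f rulesᶠ ρ
rulesᶠ-complete f ρ rules =
  rules .fuel-mono , rules .fuel-monoL , rules .Z-unfueled , rules .Z-rule , rules .S-rule ,
  rules .P-zero-rule , rules .P-suc-rule , rules .C-rule , rules .R-zero-rule , rules .R-suc-rule ,
  rules .M-rule , rules .nil-rule , rules .cons-rule

⊖-+-⊖ : ∀ a b c d → (a ⊖ b) ℤ.+ (c ⊖ d) ≡ (a + c) ⊖ (b + d)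
⊖-+-⊖ a b c d = begin
  (a ⊖ b) ℤ.+ (c ⊖ d)               ≡⟨ cong₂ ℤ._+_ ([+m]-[+n]≡m⊖n a b) ([+m]-[+n]≡m⊖n c d) ⟨
  (+ a ℤ.- + b) ℤ.+ (+ c ℤ.- + d)   ≡⟨ solve 4 (λ a b c d → (a :- b) :+ (c :- d) := (a :+ c) :- (b :+ d))
                                              refl (+ a) (+ b) (+ c) (+ d) ⟩
  + (a + c) ℤ.- + (b + d)           ≡⟨ [+m]-[+n]≡m⊖n (a + c) (b + d) ⟩
  (a + c) ⊖ (b + d)                 ∎
  where
  open ≡-Reasoning
  open ℤ-Solver

⊖≡⊖⇒ : ∀ a b c d → a ⊖ b ≡ c ⊖ d → a + d ≡ c + b
⊖≡⊖⇒ a b c d eq = +ℤ-injective (begin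
  + (a + d)                     ≡⟨ solve 3 (λ a b d → a :+ d := (a :- b) :+ (b :+ d)) refl (+ a) (+ b) (+ d) ⟩
  (+ a ℤ.- + b) ℤ.+ + (b + d)   ≡⟨ cong (ℤ._+ + (b + d)) a-b≡c-d ⟩
  (+ c ℤ.- + d) ℤ.+ + (b + d)   ≡⟨ solve 3 (λ c b d → (c :- d) :+ (b :+ d) := c :+ b) refl (+ c) (+ b) (+ d) ⟩
  + (c + b)                     ∎)
  where
  open ≡-Reasoning
  open ℤ-Solver
  a-b≡c-d : + a ℤ.- + b ≡ + c ℤ.- + d
  a-b≡c-d = trans ([+m]-[+n]≡m⊖n a b) (trans eq (sym ([+m]-[+n]≡m⊖n c d)))

⊖≡⊖⇐ : ∀ a b c d → a + d ≡ c + b → a ⊖ b ≡ c ⊖ d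
⊖≡⊖⇐ a b c d eq = begin
  a ⊖ b                      ≡⟨ [+m]-[+n]≡m⊖n a b ⟨
  + a ℤ.- + b                ≡⟨ solve 3 (λ a b d → a :- b := (a :+ d) :- (b :+ d)) refl (+ a) (+ b) (+ d) ⟩
  + (a + d) ℤ.- + (b + d)    ≡⟨ cong (λ w → + w ℤ.- + (b + d)) eq ⟩
  + (c + b) ℤ.- + (b + d)    ≡⟨ solve 3 (λ c b d → (c :+ b) :- (b :+ d) := c :- d) refl (+ c) (+ b) (+ d) ⟩
  + c ℤ.- + d                ≡⟨ [+m]-[+n]≡m⊖n c d ⟩
  c ⊖ d                      ∎
  where
  open ≡-Reasoning
  open ℤ-Solver

CodesInt : ℕ → ℕ → ℕ → Set
CodesInt n p q = Σ ℕ λ s → Σ ℕ λ a → IsPair n s a ×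
  (((s ≡ 0) × ((p ≡ a) × (q ≡ 0))) ⊎ ((0 < s) × ((p ≡ 0) × (q ≡ suc a))))

codesIntᶠ : ℕ → ℕ → ℕ → Formula
codesIntᶠ i j k = ∃ᶠ (∃ᶠ (IsPairᶠ (# (2 + i)) (# 1) (# 0) ∧
  (((# 1 ≐ zer) ∧ (# (2 + j) ≐ # 0) ∧ (# (2 + k) ≐ zer)) ∨
   ((zer ≺ # 1) ∧ (# (2 + j) ≐ zer) ∧ (# (2 + k) ≐ succ (# 0))))))

CodesInt-sound : ∀ n {p q} → CodesInt n p q → decodeℤ n ≡ p ⊖ q
CodesInt-sound n (zero , a , pr , inj₁ (_ , refl , refl)) with unpair n | IsPair⇒unpair {n} {0} {a} pr
... | .(0 , a) | refl = refl
CodesInt-sound n (suc s , a , pr , inj₂ (_ , refl , refl)) with unpair n | IsPair⇒unpair {n} {suc s} {a} pr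
... | .(suc s , a) | refl = refl

CodesInt-canonical : ∀ n → Σ ℕ λ p → Σ ℕ λ q → CodesInt n p q
CodesInt-canonical n with unpair n in eq
... | zero  , a = a , 0 , 0 , a , unpair⇒IsPair n eq , inj₁ (refl , refl , refl)
... | suc s , a = 0 , suc a , suc s , a , unpair⇒IsPair n eq , inj₂ (s≤s z≤n , refl , refl)

addIntᶠ : ℕ → ℕ → ℕ → Formula
addIntᶠ i j k = ∃ᶠ (∃ᶠ (∃ᶠ (∃ᶠ (∃ᶠ (∃ᶠ (codesIntᶠ (6 + i) 5 4 ∧ codesIntᶠ (6 + j) 3 2 ∧ codesIntᶠ (6 + k) 1 0 ∧
  (((# 5 +ₜ # 3) +ₜ # 0) ≐ (# 1 +ₜ (# 4 +ₜ # 2)))))))))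

eqIntᶠ : ℕ → ℕ → Formula
eqIntᶠ i j = ∃ᶠ (∃ᶠ (∃ᶠ (∃ᶠ (codesIntᶠ (4 + i) 3 2 ∧ codesIntᶠ (4 + j) 1 0 ∧ ((# 3 +ₜ # 0) ≐ (# 1 +ₜ # 2))))))

module _ (f : ℕ → Bool) (ρ : Env) where

  addIntᶠ-sound : ∀ i j k → Sat f (addIntᶠ i j k) ρ → decodeℤ (ρ i) ℤ.+ decodeℤ (ρ j) ≡ decodeℤ (ρ k)
  addIntᶠ-sound i j k (p₁ , q₁ , p₂ , q₂ , p₃ , q₃ , c₁ , c₂ , c₃ , eq) = begin
    decodeℤ (ρ i) ℤ.+ decodeℤ (ρ j)   ≡⟨ cong₂ ℤ._+_ (CodesInt-sound (ρ i) c₁) (CodesInt-sound (ρ j) c₂) ⟩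
    (p₁ ⊖ q₁) ℤ.+ (p₂ ⊖ q₂)           ≡⟨ ⊖-+-⊖ p₁ q₁ p₂ q₂ ⟩
    (p₁ + p₂) ⊖ (q₁ + q₂)             ≡⟨ ⊖≡⊖⇐ (p₁ + p₂) (q₁ + q₂) p₃ q₃ eq ⟩
    p₃ ⊖ q₃                           ≡⟨ CodesInt-sound (ρ k) c₃ ⟨
    decodeℤ (ρ k)                     ∎
    where open ≡-Reasoning

  addIntᶠ-complete : ∀ i j k → decodeℤ (ρ i) ℤ.+ decodeℤ (ρ j) ≡ decodeℤ (ρ k) → Sat f (addIntᶠ i j k) ρ
  addIntᶠ-complete i j k sum
    with CodesInt-canonical (ρ i) | CodesInt-canonical (ρ j) | CodesInt-canonical (ρ k)
  ... | p₁ , q₁ , c₁ | p₂ , q₂ , c₂ | p₃ , q₃ , c₃ =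
    p₁ , q₁ , p₂ , q₂ , p₃ , q₃ , c₁ , c₂ , c₃ , ⊖≡⊖⇒ (p₁ + p₂) (q₁ + q₂) p₃ q₃ (begin
    (p₁ + p₂) ⊖ (q₁ + q₂)             ≡⟨ ⊖-+-⊖ p₁ q₁ p₂ q₂ ⟨
    (p₁ ⊖ q₁) ℤ.+ (p₂ ⊖ q₂)           ≡⟨ cong₂ ℤ._+_ (CodesInt-sound (ρ i) c₁) (CodesInt-sound (ρ j) c₂) ⟨
    decodeℤ (ρ i) ℤ.+ decodeℤ (ρ j)   ≡⟨ sum ⟩
    decodeℤ (ρ k)                     ≡⟨ CodesInt-sound (ρ k) c₃ ⟩
    p₃ ⊖ q₃                           ∎)
    where open ≡-Reasoning

  eqIntᶠ-sound : ∀ i j → Sat f (eqIntᶠ i j) ρ → decodeℤ (ρ i) ≡ decodeℤ (ρ j)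
  eqIntᶠ-sound i j (p₁ , q₁ , p₂ , q₂ , c₁ , c₂ , eq) =
    trans (CodesInt-sound (ρ i) c₁) (trans (⊖≡⊖⇐ p₁ q₁ p₂ q₂ eq) (sym (CodesInt-sound (ρ j) c₂)))

  eqIntᶠ-complete : ∀ i j → decodeℤ (ρ i) ≡ decodeℤ (ρ j) → Sat f (eqIntᶠ i j) ρ
  eqIntᶠ-complete i j eq with CodesInt-canonical (ρ i) | CodesInt-canonical (ρ j)
  ... | p₁ , q₁ , c₁ | p₂ , q₂ , c₂ = p₁ , q₁ , p₂ , q₂ , c₁ , c₂ ,
    ⊖≡⊖⇒ p₁ q₁ p₂ q₂ (trans (sym (CodesInt-sound (ρ i) c₁)) (trans eq (CodesInt-sound (ρ j) c₂)))

encodeℤ : ℤ → ℕ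
encodeℤ (+ a)    = pair 0 a
encodeℤ -[1+ a ] = pair 1 a

decodeℤ-encodeℤ : ∀ z → decodeℤ (encodeℤ z) ≡ z
decodeℤ-encodeℤ (+ a) with unpair (pair 0 a) | unpair-pair 0 a refl
... | .(0 , a) | refl = refl
decodeℤ-encodeℤ -[1+ a ] with unpair (pair 1 a) | unpair-pair 1 a refl
... | .(1 , a) | refl = refl

encodeVec : ∀ d → ℤ^ d → ℕ
encodeVec zero    []      = 0
encodeVec (suc d) (z ∷ v) = pair (encodeℤ z) (encodeVec d v)

decodeVec-IsPair : ∀ d {n a r} → IsPair n a r → decodeVec (suc d) n ≡ decodeℤ a ∷ decodeVec d r
decodeVec-IsPair d {n} {a} {r} pr =
  cong (λ (a , r) → decodeℤ a ∷ decodeVec d r) (IsPair⇒unpair {n} {a} {r} pr)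

decodeVec-encodeVec : ∀ d v → decodeVec d (encodeVec d v) ≡ v
decodeVec-encodeVec zero    []      = refl
decodeVec-encodeVec (suc d) (z ∷ v) =
  trans (decodeVec-IsPair d {pair (encodeℤ z) (encodeVec d v)} {encodeℤ z} {encodeVec d v}
                          (pair-IsPair (encodeℤ z) (encodeVec d v)))
        (cong₂ _∷_ (decodeℤ-encodeℤ z) (decodeVec-encodeVec d v))

decodeVec-zero : ∀ d → decodeVec d 0 ≡ 𝟎
decodeVec-zero zero    = refl
decodeVec-zero (suc d) = cong (+ 0 ∷_) (decodeVec-zero d)

addVecᶠ : ℕ → ℕ → ℕ → ℕ → Formula
addVecᶠ zero    i j k = zer ≐ zer
addVecᶠ (suc d) i j k = ∃ᶠ (∃ᶠ (∃ᶠ (∃ᶠ (∃ᶠ (∃ᶠ (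
  IsPairᶠ (# (6 + i)) (# 5) (# 4) ∧ IsPairᶠ (# (6 + j)) (# 3) (# 2) ∧ IsPairᶠ (# (6 + k)) (# 1) (# 0) ∧
  addIntᶠ 5 3 1 ∧ addVecᶠ d 4 2 0))))))

eqVecᶠ : ℕ → ℕ → ℕ → Formula
eqVecᶠ zero    i j = zer ≐ zer
eqVecᶠ (suc d) i j = ∃ᶠ (∃ᶠ (∃ᶠ (∃ᶠ (
  IsPairᶠ (# (4 + i)) (# 3) (# 2) ∧ IsPairᶠ (# (4 + j)) (# 1) (# 0) ∧ eqIntᶠ 3 1 ∧ eqVecᶠ d 2 0))))

module _ (f : ℕ → Bool) where

  addVecᶠ-sound : ∀ d ρ i j k → Sat f (addVecᶠ d i j k) ρ →
    decodeVec d (ρ i) ⊕ decodeVec d (ρ j) ≡ decodeVec d (ρ k)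
  addVecᶠ-sound zero    ρ i j k _ = refl
  addVecᶠ-sound (suc d) ρ i j k (a₁ , r₁ , a₂ , r₂ , a₃ , r₃ , pr₁ , pr₂ , pr₃ , head , tail) = begin
    decodeVec (suc d) (ρ i) ⊕ decodeVec (suc d) (ρ j)
      ≡⟨ cong₂ _⊕_ (decodeVec-IsPair d {ρ i} {a₁} {r₁} pr₁) (decodeVec-IsPair d {ρ j} {a₂} {r₂} pr₂) ⟩
    (decodeℤ a₁ ℤ.+ decodeℤ a₂) ∷ (decodeVec d r₁ ⊕ decodeVec d r₂)
      ≡⟨ cong₂ _∷_ (addIntᶠ-sound f ρ′ 5 3 1 head) (addVecᶠ-sound d ρ′ 4 2 0 tail) ⟩
    decodeℤ a₃ ∷ decodeVec d r₃
      ≡⟨ decodeVec-IsPair d {ρ k} {a₃} {r₃} pr₃ ⟨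
    decodeVec (suc d) (ρ k) ∎
    where
    open ≡-Reasoning
    ρ′ = r₃ ∷ₑ (a₃ ∷ₑ (r₂ ∷ₑ (a₂ ∷ₑ (r₁ ∷ₑ (a₁ ∷ₑ ρ)))))

  addVecᶠ-complete : ∀ d ρ i j k → decodeVec d (ρ i) ⊕ decodeVec d (ρ j) ≡ decodeVec d (ρ k) →
    Sat f (addVecᶠ d i j k) ρ
  addVecᶠ-complete zero    ρ i j k _   = refl
  addVecᶠ-complete (suc d) ρ i j k sum =
    a₁ , r₁ , a₂ , r₂ , a₃ , r₃ , unpair-IsPair (ρ i) , unpair-IsPair (ρ j) , unpair-IsPair (ρ k) ,
    addIntᶠ-complete f ρ′ 5 3 1 (proj₁ (∷-injective sum)) ,
    addVecᶠ-complete d ρ′ 4 2 0 (proj₂ (∷-injective sum))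
    where
    a₁ = proj₁ (unpair (ρ i))
    r₁ = proj₂ (unpair (ρ i))
    a₂ = proj₁ (unpair (ρ j))
    r₂ = proj₂ (unpair (ρ j))
    a₃ = proj₁ (unpair (ρ k))
    r₃ = proj₂ (unpair (ρ k))
    ρ′ = r₃ ∷ₑ (a₃ ∷ₑ (r₂ ∷ₑ (a₂ ∷ₑ (r₁ ∷ₑ (a₁ ∷ₑ ρ)))))

  eqVecᶠ-sound : ∀ d ρ i j → Sat f (eqVecᶠ d i j) ρ → decodeVec d (ρ i) ≡ decodeVec d (ρ j)
  eqVecᶠ-sound zero    ρ i j _ = refl
  eqVecᶠ-sound (suc d) ρ i j (a₁ , r₁ , a₂ , r₂ , pr₁ , pr₂ , head , tail) =
    trans (decodeVec-IsPair d {ρ i} {a₁} {r₁} pr₁)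
      (trans (cong₂ _∷_ (eqIntᶠ-sound f ρ′ 3 1 head) (eqVecᶠ-sound d ρ′ 2 0 tail))
        (sym (decodeVec-IsPair d {ρ j} {a₂} {r₂} pr₂)))
    where ρ′ = r₂ ∷ₑ (a₂ ∷ₑ (r₁ ∷ₑ (a₁ ∷ₑ ρ)))

  eqVecᶠ-complete : ∀ d ρ i j → decodeVec d (ρ i) ≡ decodeVec d (ρ j) → Sat f (eqVecᶠ d i j) ρ
  eqVecᶠ-complete zero    ρ i j _  = refl
  eqVecᶠ-complete (suc d) ρ i j eq =
    a₁ , r₁ , a₂ , r₂ , unpair-IsPair (ρ i) , unpair-IsPair (ρ j) ,
    eqIntᶠ-complete f ρ′ 3 1 (proj₁ (∷-injective eq)) , eqVecᶠ-complete d ρ′ 2 0 (proj₂ (∷-injective eq))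
    where
    a₁ = proj₁ (unpair (ρ i))
    r₁ = proj₂ (unpair (ρ i))
    a₂ = proj₁ (unpair (ρ j))
    r₂ = proj₂ (unpair (ρ j))
    ρ′ = r₂ ∷ₑ (a₂ ∷ₑ (r₁ ∷ₑ (a₁ ∷ₑ ρ)))

-- The formulas below are read in the context (e , k , …) of an instance.  Atoms tagged 0 say
-- that position decodeVec d c carries symbol s, atoms tagged 1 that q occurs in decodeList l;
-- a pattern entry (jn , sn) asks for symbol sn mod k + 1 at offset decodeVec d jn.
Xᶠ : Term → Term → Formula
Xᶠ c s = atomᶠ (numeral 0 ∷ c ∷ s ∷ [])

∈ᶠ : Term → Term → Formula
∈ᶠ q l = atomᶠ (numeral 1 ∷ q ∷ l ∷ [])

totalᶠ : Formula
totalᶠ = ∀ᶠ (∃ᶠ ((# 0 ≺ succ (# 3)) ∧ Xᶠ (# 1) (# 0)))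

functionalᶠ : ℕ → Formula
functionalᶠ d = ∀ⁿ 4 (eqVecᶠ d 3 2 ⊃ Xᶠ (# 3) (# 1) ⊃ Xᶠ (# 2) (# 0) ⊃ (# 1 ≐ # 0))

membershipᶠ : Formula
membershipᶠ = ∀ⁿ 2 (∈ᶠ (# 1) (# 0) ⊃ ∃ᶠ ((# 1 ≐ succ (# 0)) ∧
  ∃ᶠ (∃ᶠ (IsPairᶠ (# 2) (# 1) (# 0) ∧ ((# 4 ≐ # 1) ∨ ∈ᶠ (# 4) (# 0))))))

computesᶠ : Formula
computesᶠ = ∃ᶠ (∃ᶠ (IsPairᶠ (# 0) (# 3) zer ∧ Tᶠ (# 1) (# 5) (# 5) (succ (# 0)) (# 4)))

violatedᶠ : ℕ → Formula
violatedᶠ d = ∃ᶠ (∈ᶠ (# 0) (# 3) ∧ ∃ᶠ (∃ᶠ (IsPairᶠ (# 2) (# 1) (# 0) ∧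
  ∃ᶠ (addVecᶠ d 4 2 0 ∧ ∃ᶠ (Xᶠ (# 1) (# 0) ∧
  ∃ᶠ (∃ᶠ ((# 4 ≐ ((# 1 *ₜ succ (# 11)) +ₜ # 0)) ∧ (# 0 ≺ succ (# 11)) ∧ ((# 2 ≐ # 0) ⊃ ⊥ᶠ))))))))

avoidsᶠ : ℕ → Formula
avoidsᶠ d = ∀ⁿ 3 (computesᶠ ⊃ violatedᶠ d)

shiftDiffersᶠ : ℕ → Formula
shiftDiffersᶠ d =
  ∃ᶠ (∃ᶠ (∃ᶠ (∃ᶠ (addVecᶠ d 3 5 2 ∧ Xᶠ (# 2) (# 1) ∧ Xᶠ (# 3) (# 0) ∧ ((# 1 ≐ # 0) ⊃ ⊥ᶠ)))))

-- The variable equated to 0 is there so that eqVecᶠ can compare the period with the zero vector.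
aperiodicᶠ : ℕ → Formula
aperiodicᶠ d = ∀ⁿ 2 ((# 0 ≐ zer) ⊃ (eqVecᶠ d 1 0 ⊃ ⊥ᶠ) ⊃ shiftDiffersᶠ d)

solutionᶠ : ℕ → Formula
solutionᶠ d = totalᶠ ∧ functionalᶠ d ∧ membershipᶠ ∧ rulesᶠ ∧ avoidsᶠ d ∧ aperiodicᶠ d

dominoᶠ : ℕ → Formula
dominoᶠ d = ∃ᶠ (∃ᶠ (IsPairᶠ (# 2) (# 1) (# 0) ∧ solutionᶠ d))

Solution : ℕ → ℕ → ℕ → Set
Solution d k e = Σ (Config d (Fin (suc k))) λ x → InSubshift (EffFamily d k e) x × Aperiodic x

AperiodicDomino-intro : ∀ d n {k e} → unpair n ≡ (k , e) → Solution d k e → AperiodicDomino d n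
AperiodicDomino-intro d n eq sol with unpair n | eq
... | _ | refl = sol

AperiodicDomino-elim : ∀ d n → AperiodicDomino d n → Solution d (proj₁ (unpair n)) (proj₂ (unpair n))
AperiodicDomino-elim d n sol with unpair n
... | _ = sol

toℕ-decodeSym : ∀ k {sn} qq {r} → sn ≡ qq * suc k + r → r < suc k → toℕ (decodeSym k sn) ≡ r
toℕ-decodeSym k {sn} qq {r} sn≡ r<k = begin
  toℕ (decodeSym k sn)  ≡⟨ toℕ-fromℕ< (m%n<n sn (suc k)) ⟩
  sn % suc k            ≡⟨ cong (_% suc k) (trans sn≡ (+-comm (qq * suc k) r)) ⟩
  (r + qq * suc k) % suc k ≡⟨ [m+kn]%n≡m%n r qq (suc k) ⟩
  r % suc k             ≡⟨ m<n⇒m%n≡m r<k ⟩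
  r                     ∎
  where open ≡-Reasoning

module _ {d k} (x : Config d (Fin (suc k))) (i : ℤ^ d) (m : ℕ) where

  AppearsAt-entry : ∀ {q} → q ∈ decodeList m → AppearsAt (decodePattern d k m) x i →
    x (i ⊕ proj₁ (decodeEntry d k q)) ≡ proj₂ (decodeEntry d k q)
  AppearsAt-entry q∈ appears =
    All.lookup appears (subst (_ ∈_) (sym (decodePattern≡map d k m)) (∈-map⁺ (decodeEntry d k) q∈))

  ¬AppearsAt⇒violated : ¬ AppearsAt (decodePattern d k m) x i →
    Σ ℕ λ q → q ∈ decodeList m × x (i ⊕ proj₁ (decodeEntry d k q)) ≢ proj₂ (decodeEntry d k q)
  ¬AppearsAt⇒violated ¬appears with find (¬All⇒Any¬ (λ (j , a) → x (i ⊕ j) ≟ᶠ a) _ ¬appears)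
  ... | entry , entry∈ , violated
    with ∈-map⁻ (decodeEntry d k) (subst (entry ∈_) (decodePattern≡map d k m) entry∈)
  ... | q , q∈ , refl = q , q∈ , violated

module _ (f : ℕ → Bool) (ρ : Env) (membership : Sat f membershipᶠ ρ) where

  ∈-sound : ∀ fuel l q → l ≤ fuel → Holds f (1 ∷ q ∷ l ∷ []) → q ∈ decodeList l
  ∈-sound fuel l q le h with membership q l h
  ∈-sound zero       .(suc p) q ()       h | p , refl , _
  ∈-sound (suc fuel) .(suc p) q (s≤s le) h | p , refl , a , r , pr , head-or-tail =
    subst (q ∈_) (sym (decodeList-IsPair {p} {a} {r} pr)) (∈-∷ head-or-tail)
    where
    ∈-∷ : q ≡ a ⊎ Holds f (1 ∷ q ∷ r ∷ []) → q ∈ a ∷ decodeList r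
    ∈-∷ (inj₁ q≡a) = here q≡a
    ∈-∷ (inj₂ h′)  = there (∈-sound fuel r q (≤-trans (IsPair⇒≤ {p} {a} {r} pr) le) h′)

module Soundness (d : ℕ) (f : ℕ → Bool) (k e : ℕ) (ρ : Env)
  (total      : Sat f totalᶠ (e ∷ₑ (k ∷ₑ ρ)))
  (functional : Sat f (functionalᶠ d) (e ∷ₑ (k ∷ₑ ρ))) where

  x : Config d (Fin (suc k))
  x w = fromℕ< (proj₁ (proj₂ (total (encodeVec d w))))

  x-Holds : ∀ {c s} → Holds f (0 ∷ c ∷ s ∷ []) → toℕ (x (decodeVec d c)) ≡ s
  x-Holds {c} {s} h =
    trans (toℕ-fromℕ< _) (functional c₀ c _ s same-position (proj₂ (proj₂ (total c₀))) h)
    where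
    c₀ = encodeVec d (decodeVec d c)
    same-position : Sat f (eqVecᶠ d 3 2) (s ∷ₑ (_ ∷ₑ (c ∷ₑ (c₀ ∷ₑ (e ∷ₑ (k ∷ₑ ρ))))))
    same-position = eqVecᶠ-complete f d _ 3 2 (decodeVec-encodeVec d (decodeVec d c))

  violatedᶠ-sound : ∀ {m t i} → Sat f membershipᶠ (e ∷ₑ (k ∷ₑ ρ)) →
    Sat f (violatedᶠ d) (i ∷ₑ (t ∷ₑ (m ∷ₑ (e ∷ₑ (k ∷ₑ ρ))))) →
    ¬ AppearsAt (decodePattern d k m) x (decodeVec d i)
  violatedᶠ-sound {m} {t} {i} membership
    (q , q∈ , jn , sn , pq , c , sum , s , xc , qq , r , sn≡ , r<1+k , s≢r) appears = s≢r (begin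
      s                                         ≡⟨ x-Holds xc ⟨
      toℕ (x (decodeVec d c))                   ≡⟨ cong (toℕ ∘ x) position ⟨
      toℕ (x (decodeVec d i ⊕ decodeVec d jn))  ≡⟨ cong toℕ entry ⟩
      toℕ (decodeSym k sn)                      ≡⟨ toℕ-decodeSym k qq sn≡ r<1+k ⟩
      r                                         ∎)
    where
    open ≡-Reasoning
    position : decodeVec d i ⊕ decodeVec d jn ≡ decodeVec d c
    position = addVecᶠ-sound f d (c ∷ₑ (sn ∷ₑ (jn ∷ₑ (q ∷ₑ (i ∷ₑ (t ∷ₑ (m ∷ₑ (e ∷ₑ (k ∷ₑ ρ))))))))) 4 2 0 sum
    entry : x (decodeVec d i ⊕ decodeVec d jn) ≡ decodeSym k sn
    entry = subst (λ (jn , sn) → x (decodeVec d i ⊕ decodeVec d jn) ≡ decodeSym k sn)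
      (IsPair⇒unpair {q} {jn} {sn} pq)
      (AppearsAt-entry x (decodeVec d i) m (∈-sound f (e ∷ₑ (k ∷ₑ ρ)) membership m m q ≤-refl q∈) appears)

  x-inSubshift : Sat f membershipᶠ (e ∷ₑ (k ∷ₑ ρ)) → Sat f rulesᶠ (e ∷ₑ (k ∷ₑ ρ)) →
    Sat f (avoidsᶠ d) (e ∷ₑ (k ∷ₑ ρ)) → InSubshift (EffFamily d k e) x
  x-inSubshift membership rules avoids .(decodePattern d k m) (m , (t , ev) , refl) (i , appears) =
    violatedᶠ-sound membership (avoids m t (encodeVec d i) (computes tabled))
      (subst (AppearsAt _ x) (sym (decodeVec-encodeVec d i)) appears)
    where
    tabled : Σ ℕ λ ef → OracleTable f 2 ef e e (suc (pair t 0)) m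
    tabled = Eval⇒table (rulesᶠ-sound f (e ∷ₑ (k ∷ₑ ρ)) rules) ev e e _ refl (decodeList-cons t refl)
    computes : (Σ ℕ λ ef → OracleTable f 2 ef e e (suc (pair t 0)) m) →
      Sat f computesᶠ (encodeVec d i ∷ₑ (t ∷ₑ (m ∷ₑ (e ∷ₑ (k ∷ₑ ρ)))))
    computes (ef , table) = ef , pair t 0 , pair-IsPair t 0 , table

  shiftDiffersᶠ-sound : ∀ {w} → Sat f (shiftDiffersᶠ d) (0 ∷ₑ (encodeVec d w ∷ₑ (e ∷ₑ (k ∷ₑ ρ)))) →
    Σ (ℤ^ d) λ i → x (i ⊕ w) ≢ x i
  shiftDiffersᶠ-sound {w} (i , c , s , s′ , sum , xc , xi , s≢s′) = decodeVec d i , λ moved → s≢s′ (begin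
    s                                ≡⟨ x-Holds xc ⟨
    toℕ (x (decodeVec d c))          ≡⟨ cong (toℕ ∘ x) position ⟨
    toℕ (x (decodeVec d i ⊕ w))      ≡⟨ cong toℕ moved ⟩
    toℕ (x (decodeVec d i))          ≡⟨ x-Holds xi ⟩
    s′                               ∎)
    where
    open ≡-Reasoning
    position : decodeVec d i ⊕ w ≡ decodeVec d c
    position = trans (cong (decodeVec d i ⊕_) (sym (decodeVec-encodeVec d w)))
      (addVecᶠ-sound f d (s′ ∷ₑ (s ∷ₑ (c ∷ₑ (i ∷ₑ (0 ∷ₑ (encodeVec d w ∷ₑ (e ∷ₑ (k ∷ₑ ρ)))))))) 3 5 2 sum)

  x-aperiodic : Sat f (aperiodicᶠ d) (e ∷ₑ (k ∷ₑ ρ)) → Aperiodic x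
  x-aperiodic aperiodic w w≢0 = shiftDiffersᶠ-sound (aperiodic (encodeVec d w) 0 refl w≢0′)
    where
    w≢0′ : ¬ Sat f (eqVecᶠ d 1 0) (0 ∷ₑ (encodeVec d w ∷ₑ (e ∷ₑ (k ∷ₑ ρ))))
    w≢0′ eq = w≢0 (trans (sym (decodeVec-encodeVec d w))
                         (trans (eqVecᶠ-sound f d _ 1 0 eq) (decodeVec-zero d)))

module Completeness (d k e : ℕ) (x : Config d (Fin (suc k)))
  (inSubshift : InSubshift (EffFamily d k e) x) (aperiodic : Aperiodic x) (ρ : Env) where

  bit : ℕ → ℕ → ℕ → ℕ → ℕ → ℕ → Bool
  bit 0 c s _ _ _ = does (toℕ (x (decodeVec d c)) ≟ s)
  bit 1 q l _ _ _ = does (q ∈? decodeList l)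
  bit 2 ef df e′ n y = does (Maybe.≡-dec _≟_ (eval ef (decodeCodeF df e′) (decodeList n)) (just y))
  bit 3 ef df b n ys =
    does (Maybe.≡-dec (List.≡-dec _≟_) (evalList ef (decodeCodesF df b) (decodeList n)) (just (decodeList ys)))
  bit _ _ _ _ _ _ = false

  opaque
    oracle : ℕ → Bool
    oracle i =
      bit (component 0 i) (component 1 i) (component 2 i) (component 3 i) (component 4 i) (component 5 i)

  opaque
    unfolding oracle

    Holds-oracle : ∀ a₀ a₁ a₂ a₃ a₄ a₅ →
      Holds oracle (a₀ ∷ a₁ ∷ a₂ ∷ a₃ ∷ a₄ ∷ a₅ ∷ []) ⇔ bit a₀ a₁ a₂ a₃ a₄ a₅ ≡ true
    Holds-oracle a₀ a₁ a₂ a₃ a₄ a₅ = mk⇔ (trans (sym oracle-tuple)) (trans oracle-tuple)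
      where
      vs : List ℕ
      vs = a₀ ∷ a₁ ∷ a₂ ∷ a₃ ∷ a₄ ∷ a₅ ∷ []
      oracle-tuple : oracle (tuple vs) ≡ bit a₀ a₁ a₂ a₃ a₄ a₅
      oracle-tuple rewrite component-tuple 0 vs | component-tuple 1 vs | component-tuple 2 vs
                         | component-tuple 3 vs | component-tuple 4 vs | component-tuple 5 vs = refl

  -- Short atoms are padded with zeros: tuple (0 ∷ c ∷ s ∷ []) is tuple (0 ∷ c ∷ s ∷ 0 ∷ 0 ∷ 0 ∷ []).
  X⇔ : ∀ c s → Holds oracle (0 ∷ c ∷ s ∷ []) ⇔ toℕ (x (decodeVec d c)) ≡ s
  X⇔ c s = does≡true⇔ (toℕ (x (decodeVec d c)) ≟ s) ⇔-∘ Holds-oracle 0 c s 0 0 0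

  ∈⇔ : ∀ q l → Holds oracle (1 ∷ q ∷ l ∷ []) ⇔ q ∈ decodeList l
  ∈⇔ q l = does≡true⇔ (q ∈? decodeList l) ⇔-∘ Holds-oracle 1 q l 0 0 0

  T⇔ : ∀ ef df e′ n y → EvalTable ef df e′ n y ⇔ OracleTable oracle 2 ef df e′ n y
  T⇔ ef df e′ n y = ⇔-sym (does≡true⇔ (Maybe.≡-dec _≟_ (eval ef (decodeCodeF df e′) (decodeList n)) (just y))
                             ⇔-∘ Holds-oracle 2 ef df e′ n y)

  TL⇔ : ∀ ef df b n ys → EvalListTable ef df b n ys ⇔ OracleTable oracle 3 ef df b n ys
  TL⇔ ef df b n ys = ⇔-sym
    (does≡true⇔ (Maybe.≡-dec (List.≡-dec _≟_) (evalList ef (decodeCodesF df b) (decodeList n))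
                                               (just (decodeList ys)))
      ⇔-∘ Holds-oracle 3 ef df b n ys)

  total : Sat oracle totalᶠ (e ∷ₑ (k ∷ₑ ρ))
  total c = toℕ (x (decodeVec d c)) , toℕ<n _ , X⇔ c _ .from refl

  functional : Sat oracle (functionalᶠ d) (e ∷ₑ (k ∷ₑ ρ))
  functional c c′ s s′ same h h′ = trans (sym (X⇔ c s .to h))
    (trans (cong (toℕ ∘ x) (eqVecᶠ-sound oracle d _ 3 2 same)) (X⇔ c′ s′ .to h′))

  membership : Sat oracle membershipᶠ (e ∷ₑ (k ∷ₑ ρ))
  membership q zero    h with () ← ∈⇔ q 0 .to h
  membership q (suc p) h =
    p , refl , proj₁ (unpair p) , proj₂ (unpair p) , unpair-IsPair p ,
    head-or-tail (subst (q ∈_) (decodeList-suc p) (∈⇔ q (suc p) .to h))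
    where
    head-or-tail : q ∈ proj₁ (unpair p) ∷ decodeList (proj₂ (unpair p)) →
      q ≡ proj₁ (unpair p) ⊎ Holds oracle (1 ∷ q ∷ proj₂ (unpair p) ∷ [])
    head-or-tail (here q≡a) = inj₁ q≡a
    head-or-tail (there q∈) = inj₂ (∈⇔ q _ .from q∈)

  rules : Sat oracle rulesᶠ (e ∷ₑ (k ∷ₑ ρ))
  rules = rulesᶠ-complete oracle (e ∷ₑ (k ∷ₑ ρ)) (EvalRules-resp T⇔ TL⇔ evalRules)

  violated : ∀ m t i → ¬ AppearsAt (decodePattern d k m) x (decodeVec d i) →
    Sat oracle (violatedᶠ d) (i ∷ₑ (t ∷ₑ (m ∷ₑ (e ∷ₑ (k ∷ₑ ρ)))))
  violated m t i ¬appears with ¬AppearsAt⇒violated x (decodeVec d i) m ¬appears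
  ... | q , q∈ , q-violated =
    q , ∈⇔ q m .from q∈ , jn , sn , unpair-IsPair q , c ,
    addVecᶠ-complete oracle d _ 4 2 0 (sym (decodeVec-encodeVec d _)) ,
    s , X⇔ c s .from refl , sn / suc k , sn % suc k ,
    trans (m≡m%n+[m/n]*n sn (suc k)) (+-comm (sn % suc k) _) , m%n<n sn (suc k) , s≢sn%1+k
    where
    jn = proj₁ (unpair q)
    sn = proj₂ (unpair q)
    c = encodeVec d (decodeVec d i ⊕ decodeVec d jn)
    s = toℕ (x (decodeVec d c))
    s≢sn%1+k : s ≢ sn % suc k
    s≢sn%1+k s≡ = q-violated (toℕ-injective (begin
      toℕ (x (decodeVec d i ⊕ decodeVec d jn)) ≡⟨ cong (toℕ ∘ x) (decodeVec-encodeVec d _) ⟨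
      s                                         ≡⟨ s≡ ⟩
      sn % suc k                                ≡⟨ toℕ-fromℕ< (m%n<n sn (suc k)) ⟨
      toℕ (decodeSym k sn)                      ∎))
      where open ≡-Reasoning

  avoids : Sat oracle (avoidsᶠ d) (e ∷ₑ (k ∷ₑ ρ))
  avoids m t i (ef , p , pr , tabled) = violated m t i λ appears →
    inSubshift _ (m , forbidden , refl) (decodeVec d i , appears)
    where
    forbidden : InRE e m
    forbidden = EvalTable⇒InRE ef e {p} {t} {m} pr (T⇔ ef e e (suc p) m .from tabled)

  shiftDiffers : ∀ p → Σ (ℤ^ d) (λ i → x (i ⊕ decodeVec d p) ≢ x i) →
    Sat oracle (shiftDiffersᶠ d) (0 ∷ₑ (p ∷ₑ (e ∷ₑ (k ∷ₑ ρ))))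
  shiftDiffers p (i , moves) = encodeVec d i , c , s , s′ ,
    addVecᶠ-complete oracle d _ 3 5 2
      (trans (cong (_⊕ decodeVec d p) (decodeVec-encodeVec d i)) (sym (decodeVec-encodeVec d _))) ,
    X⇔ c s .from refl , X⇔ (encodeVec d i) s′ .from refl , s≢s′
    where
    c = encodeVec d (i ⊕ decodeVec d p)
    s = toℕ (x (decodeVec d c))
    s′ = toℕ (x (decodeVec d (encodeVec d i)))
    s≢s′ : s ≢ s′
    s≢s′ s≡s′ = moves (toℕ-injective (begin
      toℕ (x (i ⊕ decodeVec d p))       ≡⟨ cong (toℕ ∘ x) (decodeVec-encodeVec d _) ⟨
      s                                 ≡⟨ s≡s′ ⟩
      s′                                ≡⟨ cong (toℕ ∘ x) (decodeVec-encodeVec d i) ⟩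
      toℕ (x i)                         ∎))
      where open ≡-Reasoning

  aperiodicity : Sat oracle (aperiodicᶠ d) (e ∷ₑ (k ∷ₑ ρ))
  aperiodicity p .0 refl p≢0 = shiftDiffers p (aperiodic (decodeVec d p) λ p≡𝟎 →
    p≢0 (eqVecᶠ-complete oracle d _ 1 0 (trans p≡𝟎 (sym (decodeVec-zero d)))))

  solution : Sat oracle (solutionᶠ d) (e ∷ₑ (k ∷ₑ ρ))
  solution = total , functional , membership , rules , avoids , aperiodicity

solutionᶠ-complete : ∀ d k e ρ → Solution d k e → Σ (ℕ → Bool) λ f → Sat f (solutionᶠ d) (e ∷ₑ (k ∷ₑ ρ))
solutionᶠ-complete d k e ρ (x , inSubshift , aperiodic) = C.oracle , C.solution
  where module C = Completeness d k e x inSubshift aperiodic ρ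

solutionᶠ-sound : ∀ d f k e ρ → Sat f (solutionᶠ d) (e ∷ₑ (k ∷ₑ ρ)) → Solution d k e
solutionᶠ-sound d f k e ρ (total , functional , membership , rules , avoids , aperiodic) =
  S.x , S.x-inSubshift membership rules avoids , S.x-aperiodic aperiodic
  where module S = Soundness d f k e ρ total functional

-- The argument works in every dimension.
proposition10 : (d : ℕ) → 1 ≤ d → IsΣ¹₁ (AperiodicDomino d)
proposition10 d _ = dominoᶠ d , λ n → complete n , sound n
  where
  ρ : Env
  ρ = λ _ → 0
  complete : ∀ n → AperiodicDomino d n → Σ (ℕ → Bool) λ f → Sat f (dominoᶠ d) (n ∷ₑ ρ)
  complete n sol =
    let k , e = unpair n
        f , solution = solutionᶠ-complete d k e (n ∷ₑ ρ) (AperiodicDomino-elim d n sol)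
    in f , k , e , unpair-IsPair n , solution
  sound : ∀ n → Σ (ℕ → Bool) (λ f → Sat f (dominoᶠ d) (n ∷ₑ ρ)) → AperiodicDomino d n
  sound n (f , k , e , pr , solution) =
    AperiodicDomino-intro d n (IsPair⇒unpair {n} {k} {e} pr) (solutionᶠ-sound d f k e (n ∷ₑ ρ) solution)
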